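{- Fix $m\ge1$, let $\{a_n\}_{n\ge0}$ be the $m$-gonal sequence, $I_n=[0,a_{mn+1})\cap\mathbb{Z}$, and $\mu_n=\frac{nm}{m+1}+\frac12$. For indices $j_1,j_2\ge0$ and gap lengths $g_1,g_2\ge1$, let \[ X_{j_1,j_1+g_1,j_2,j_2+g_2}(n)=\#\{z\in I_n:\ a_{j_1},a_{j_1+g_1},a_{j_2},a_{j_2+g_2}\text{ are summands in }z\text{'s decomposition, but } a_{j_1+q},a_{j_2+p}\text{ are not, for } 0<q<g_1,\ 0<p<g_2\}. \] For $g=m\alpha+\beta\ge1$ with $\alpha\ge0$, $0\le\beta<m$, let $P(g)=\beta/(m(m+1))$ if $\alpha=0$ and $P(g)=(m+1-\beta)/(m+1)^{\alpha+1}$ if $\alpha>0$. Define $\mathrm{error}(n,g_1,g_2)$ by \[ \frac{2}{|I_n|\mu_n^2}\sum_{j_1<j_2}X_{j_1,j_1+g_1,j_2,j_2+g_2}(n)=P(g_1)P(g_2)+\mathrm{error}(n,g_1,g_2). \] Then $\lim_{n\to\infty}\sum_{g_1,g_2\ge1}\mathrm{error}(n,g_1,g_2)=0$.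
   Context: Bins of an increasing sequence $\{a_n\}_{n\ge0}$: $b_0=[a_0]$, $b_k=[a_{m(k-1)+1},\dots,a_{mk}]$ for $k\ge1$. A legal $m$-gonal decomposition of $z$ is $z=a_{\ell_t}+\cdots+a_{\ell_1}$ with $\ell_1<\cdots<\ell_t$ and no two summands in the same bin. The $m$-gonal sequence: each $a_i$ is the smallest positive integer with no legal $m$-gonal decomposition using only $a_0,\dots,a_{i-1}$. Every nonnegative integer has a unique legal $m$-gonal decomposition in terms of this sequence ("$z$'s decomposition"). The sum over $j_1<j_2$ ranges over all indices with $j_1+g_1\le mn$ and $j_2+g_2\le mn$ (terms beyond these are zero). -}

module Defs where

open import Data.Nat as ℕ using (ℕ; zero; suc; _+_; _*_; _∸_; _^_; _<_; _≤_; NonZero; _≡ᵇ_)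
open import Data.Nat.DivMod using (_/_; _%_)
open import Data.Bool using (Bool; true; false; _∧_; not; if_then_else_)
open import Data.List using (List; []; _∷_; map; upTo; foldr)
open import Data.Nat.ListAction using (sum)
open import Data.Bool.ListAction using (any; all)
open import Data.List.Relation.Unary.All using (All)
open import Data.List.Relation.Unary.AllPairs using (AllPairs)
open import Data.Integer using (+_)
open import Data.Rational as ℚ using (ℚ; 0ℚ; 1/_; ≢-nonZero)
open import Data.Rational.Properties using (_≟_)
open import Data.Product using (Σ; _×_)
open import Relation.Nullary using (¬_; yes; no)
open import Relation.Binary.PropositionalEquality using (_≡_; _≢_)

-- bin index of a_i : b_0 = [a_0], b_k = [a_{m(k-1)+1}, …, a_{mk}] (k ≥ 1)
bin : (m : ℕ) → .{{NonZero m}} → ℕ → ℕ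
bin m zero    = zero
bin m (suc i) = suc (i / m)

Legal : (m : ℕ) → .{{NonZero m}} → (ℕ → ℕ) → List ℕ → ℕ → Set
Legal m a ℓs z =
  AllPairs _<_ ℓs × AllPairs (λ i j → bin m i ≢ bin m j) ℓs × sum (map a ℓs) ≡ z

HasLegalBelow : (m : ℕ) → .{{NonZero m}} → (ℕ → ℕ) → ℕ → ℕ → Set
HasLegalBelow m a i z = Σ (List ℕ) λ ℓs → All (_< i) ℓs × Legal m a ℓs z

IsMGonal : (m : ℕ) → .{{NonZero m}} → (ℕ → ℕ) → Set
IsMGonal m a = ∀ i →
  (0 < a i) × ¬ HasLegalBelow m a i (a i)
  × (∀ z → 0 < z → z < a i → HasLegalBelow m a i z)

isIn : ℕ → List ℕ → Bool
isIn j ds = any (λ x → x ≡ᵇ j) ds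

gapAt : ℕ → ℕ → List ℕ → Bool
gapAt j g ds =
  isIn j ds ∧ isIn (j + g) ds
  ∧ all (λ q → not (isIn (j + suc q) ds)) (upTo (g ∸ 1))

countB : (ℕ → Bool) → List ℕ → ℕ
countB f xs = sum (map (λ z → if f z then 1 else 0) xs)

sizeI : (m : ℕ) → (ℕ → ℕ) → ℕ → ℕ
sizeI m a n = a (m * n + 1)

-- X_{j₁,j₁+g₁,j₂,j₂+g₂}(n), where dec z is z's (unique) legal decomposition
X : (m : ℕ) → (ℕ → ℕ) → (ℕ → List ℕ) → ℕ → ℕ → ℕ → ℕ → ℕ → ℕ
X m a dec n j₁ g₁ j₂ g₂ =
  countB (λ z → gapAt j₁ g₁ (dec z) ∧ gapAt j₂ g₂ (dec z)) (upTo (sizeI m a n))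

-- Σ_{j₁<j₂} X(n), over j₂ ≤ mn (all other terms vanish)
sumX : (m : ℕ) → (ℕ → ℕ) → (ℕ → List ℕ) → ℕ → ℕ → ℕ → ℕ
sumX m a dec n g₁ g₂ =
  sum (map (λ j₂ → sum (map (λ j₁ → X m a dec n j₁ g₁ j₂ g₂) (upTo j₂)))
           (upTo (suc (m * n))))

ℕtoℚ : ℕ → ℚ
ℕtoℚ k = (+ k) ℚ./ 1

-- total reciprocal (only ever applied to nonzero arguments below)
inv : ℚ → ℚ
inv p with p ≟ 0ℚ
... | yes _  = 0ℚ
... | no p≢0 = 1/_ p {{≢-nonZero p≢0}}

μ : (m : ℕ) → ℕ → ℚ
μ m n = ℕtoℚ (n * m) ℚ.* inv (ℕtoℚ (suc m)) ℚ.+ ℕtoℚ 1 ℚ.* inv (ℕtoℚ 2)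

P : (m : ℕ) → .{{NonZero m}} → ℕ → ℚ
P m g with g / m
... | zero  = ℕtoℚ (g % m) ℚ.* inv (ℕtoℚ (m * suc m))
... | suc α = ℕtoℚ (suc m ∸ g % m) ℚ.* inv (ℕtoℚ (suc m ^ suc (suc α)))

err : (m : ℕ) → .{{NonZero m}} → (ℕ → ℕ) → (ℕ → List ℕ) → ℕ → ℕ → ℕ → ℚ
err m a dec n g₁ g₂ =
  ℕtoℚ 2 ℚ.* inv (ℕtoℚ (sizeI m a n) ℚ.* (μ m n ℚ.* μ m n))
    ℚ.* ℕtoℚ (sumX m a dec n g₁ g₂)
  ℚ.- P m g₁ ℚ.* P m g₂

sumℚ : List ℚ → ℚ
sumℚ = foldr ℚ._+_ 0ℚ

-- square partial sum Σ_{1 ≤ g₁,g₂ ≤ K} error(n,g₁,g₂)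
errSum : (m : ℕ) → .{{NonZero m}} → (ℕ → ℕ) → (ℕ → List ℕ) → ℕ → ℕ → ℚ
errSum m a dec n K =
  sumℚ (map (λ g₁ → sumℚ (map (λ g₂ → err m a dec n (suc g₁) (suc g₂)) (upTo K))) (upTo K))

module Submission where

-- 1. The m-gonal sequence has the closed form a₀ = 1, a_{1+r+qm} = 2(r+1)(m+1)^q
--    (MGonal: greedy decompositions exist and legal sums are bounded, which pins
--    the sequence down).  So |I_n| = 2(m+1)^n, and the number of summands of z is
--    its parity bit plus the number of nonzero base-(m+1) digits of ⌊z/2⌋
--    (SummandCount).
-- 2. I_{n+1} consists of m+1 translates of I_n, giving recursions for the moments
--    Σ_z h(#summands z) and a closed form of the number T n of pairs of gaps
--    over I_n (Moments).
-- 3. Summed over all gap lengths, Σ_{j₁<j₂} X counts for each z the pairs of gaps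
--    of its decomposition, so the total equals T n once K ≥ m·n (GapCounting,
--    Counting).
-- 4. The partial sums of P equal 1 − (m+3)/(2(m+1)^α) at the end of bin α
--    (GapDistribution, using the fraction toolkit Fractions, RationalSums).
-- 5. The error sum is κ_n T n − (Σ_{g≤K} P g)² with κ_n = 2/(|I_n| μ_n²); both
--    terms tend to 1 (Normalisation, Estimates), which gives the theorem.

module Sums where

  open import Algebra.Structures using (IsCommutativeSemiring)
  open import Data.Nat as Nat using (ℕ; zero; suc; _<_; _≤_)
  import Data.Nat.Properties as ℕₚ
  open import Data.Bool using (Bool; true; false; _∧_; _∨_; not; if_then_else_)
  open import Data.Bool.Properties using (∧-identityʳ; ∨-identityʳ)
  open import Data.Bool.ListAction using (any; all)
  open import Data.List using ([]; _∷_; _++_; [_]; map; upTo; foldr)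
  open import Data.List.Properties using (upTo-∷ʳ; map-upTo; map-applyUpTo; map-++; foldr-++)
  open import Function using (_∘_)
  open import Relation.Binary.PropositionalEquality using (_≡_; refl; sym; trans; cong; cong₂; module ≡-Reasoning)

  map-upTo-suc : ∀ {B : Set} (g : ℕ → B) N → map g (upTo (suc N)) ≡ map g (upTo N) ++ [ g N ]
  map-upTo-suc g N = trans (cong (map g) (sym (upTo-∷ʳ N))) (map-++ g (upTo N) [ N ])

  module RangeSums {A : Set} {plus times : A → A → A} {0# 1# : A}
                   (isCS : IsCommutativeSemiring _≡_ plus times 0# 1#) where
    infixl 6 _+_
    infixl 7 _*_
    private
      _+_ _*_ : A → A → A
      _+_ = plus
      _*_ = times

    open IsCommutativeSemiring isCS using (+-assoc; +-comm; +-identityˡ; +-identityʳ; *-comm; distribˡ; zeroʳ)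

    ∑ : (ℕ → A) → ℕ → A
    ∑ h N = foldr _+_ 0# (map h (upTo N))

    ∑-suc : ∀ h N → ∑ h (suc N) ≡ ∑ h N + h N
    ∑-suc h N = begin
      foldr _+_ 0# (map h (upTo (suc N)))          ≡⟨ cong (foldr _+_ 0#) (map-upTo-suc h N) ⟩
      foldr _+_ 0# (map h (upTo N) ++ [ h N ])     ≡⟨ foldr-++ _+_ 0# (map h (upTo N)) [ h N ] ⟩
      foldr _+_ (h N + 0#) (map h (upTo N))        ≡⟨ cong (λ e → foldr _+_ e (map h (upTo N))) (+-identityʳ (h N)) ⟩
      foldr _+_ (h N) (map h (upTo N))             ≡⟨ foldr-seed (map h (upTo N)) (h N) ⟩
      ∑ h N + h N                                  ∎
      where
      open ≡-Reasoning
      foldr-seed : ∀ xs e → foldr _+_ e xs ≡ foldr _+_ 0# xs + e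
      foldr-seed [] e = sym (+-identityˡ e)
      foldr-seed (x ∷ xs) e = trans (cong (x +_) (foldr-seed xs e)) (sym (+-assoc x _ e))

    ∑-shift : ∀ h N → ∑ h (suc N) ≡ h 0 + ∑ (h ∘ suc) N
    ∑-shift h N = cong (h 0 +_) (cong (foldr _+_ 0#) (trans (map-applyUpTo suc h N) (sym (map-upTo (h ∘ suc) N))))

    ∑-cong< : ∀ {h h'} N → (∀ i → i < N → h i ≡ h' i) → ∑ h N ≡ ∑ h' N
    ∑-cong< zero _ = refl
    ∑-cong< {h} {h'} (suc N) e = begin
      ∑ h (suc N)    ≡⟨ ∑-suc h N ⟩
      ∑ h N + h N    ≡⟨ cong₂ _+_ (∑-cong< N (λ i i<N → e i (ℕₚ.m<n⇒m<1+n i<N))) (e N ℕₚ.≤-refl) ⟩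
      ∑ h' N + h' N  ≡⟨ sym (∑-suc h' N) ⟩
      ∑ h' (suc N)   ∎
      where open ≡-Reasoning

    ∑-cong : ∀ {h h'} N → (∀ i → h i ≡ h' i) → ∑ h N ≡ ∑ h' N
    ∑-cong N e = ∑-cong< N (λ i _ → e i)

    ∑-zero : ∀ N → ∑ (λ _ → 0#) N ≡ 0#
    ∑-zero zero = refl
    ∑-zero (suc N) = trans (∑-suc _ N) (trans (+-identityʳ _) (∑-zero N))

    ∑-+ : ∀ h h' N → ∑ (λ i → h i + h' i) N ≡ ∑ h N + ∑ h' N
    ∑-+ h h' zero = sym (+-identityʳ 0#)
    ∑-+ h h' (suc N) = begin
      ∑ (λ i → h i + h' i) (suc N)          ≡⟨ ∑-suc _ N ⟩
      ∑ (λ i → h i + h' i) N + (h N + h' N) ≡⟨ cong (_+ (h N + h' N)) (∑-+ h h' N) ⟩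
      (∑ h N + ∑ h' N) + (h N + h' N)       ≡⟨ interchange (∑ h N) (∑ h' N) (h N) (h' N) ⟩
      (∑ h N + h N) + (∑ h' N + h' N)       ≡⟨ sym (cong₂ _+_ (∑-suc h N) (∑-suc h' N)) ⟩
      ∑ h (suc N) + ∑ h' (suc N)            ∎
      where
      open ≡-Reasoning
      interchange : ∀ a b c d → (a + b) + (c + d) ≡ (a + c) + (b + d)
      interchange a b c d = begin
        (a + b) + (c + d)   ≡⟨ +-assoc a b (c + d) ⟩
        a + (b + (c + d))   ≡⟨ cong (a +_) (sym (+-assoc b c d)) ⟩
        a + ((b + c) + d)   ≡⟨ cong (λ x → a + (x + d)) (+-comm b c) ⟩
        a + ((c + b) + d)   ≡⟨ cong (a +_) (+-assoc c b d) ⟩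
        a + (c + (b + d))   ≡⟨ sym (+-assoc a c (b + d)) ⟩
        (a + c) + (b + d)   ∎

    ∑-*ˡ : ∀ k h N → ∑ (λ i → k * h i) N ≡ k * ∑ h N
    ∑-*ˡ k h zero = sym (zeroʳ k)
    ∑-*ˡ k h (suc N) = begin
      ∑ (λ i → k * h i) (suc N)     ≡⟨ ∑-suc _ N ⟩
      ∑ (λ i → k * h i) N + k * h N ≡⟨ cong (_+ k * h N) (∑-*ˡ k h N) ⟩
      k * ∑ h N + k * h N           ≡⟨ sym (distribˡ k (∑ h N) (h N)) ⟩
      k * (∑ h N + h N)             ≡⟨ cong (k *_) (sym (∑-suc h N)) ⟩
      k * ∑ h (suc N)               ∎
      where open ≡-Reasoning

    ∑-*ʳ : ∀ k h N → ∑ (λ i → h i * k) N ≡ ∑ h N * k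
    ∑-*ʳ k h N = trans (∑-cong N (λ i → *-comm (h i) k)) (trans (∑-*ˡ k h N) (*-comm k _))

    ∑-swap : ∀ (F : ℕ → ℕ → A) I J → ∑ (λ i → ∑ (F i) J) I ≡ ∑ (λ j → ∑ (λ i → F i j) I) J
    ∑-swap F zero J = sym (∑-zero J)
    ∑-swap F (suc I) J = begin
      ∑ (λ i → ∑ (F i) J) (suc I)                        ≡⟨ ∑-suc (λ i → ∑ (F i) J) I ⟩
      ∑ (λ i → ∑ (F i) J) I + ∑ (F I) J                  ≡⟨ cong (_+ ∑ (F I) J) (∑-swap F I J) ⟩
      ∑ (λ j → ∑ (λ i → F i j) I) J + ∑ (F I) J          ≡⟨ sym (∑-+ (λ j → ∑ (λ i → F i j) I) (F I) J) ⟩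
      ∑ (λ j → ∑ (λ i → F i j) I + F I j) J              ≡⟨ ∑-cong J (λ j → sym (∑-suc (λ i → F i j) I)) ⟩
      ∑ (λ j → ∑ (λ i → F i j) (suc I)) J                ∎
      where open ≡-Reasoning

    ∑-split : ∀ h I J → ∑ h (I Nat.+ J) ≡ ∑ h I + ∑ (λ z → h (I Nat.+ z)) J
    ∑-split h I zero = trans (cong (∑ h) (ℕₚ.+-identityʳ I)) (sym (+-identityʳ _))
    ∑-split h I (suc J) = begin
      ∑ h (I Nat.+ suc J)                                ≡⟨ cong (∑ h) (ℕₚ.+-suc I J) ⟩
      ∑ h (suc (I Nat.+ J))                              ≡⟨ ∑-suc h (I Nat.+ J) ⟩
      ∑ h (I Nat.+ J) + h (I Nat.+ J)                      ≡⟨ cong (_+ h (I Nat.+ J)) (∑-split h I J) ⟩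
      (∑ h I + ∑ (λ z → h (I Nat.+ z)) J) + h (I Nat.+ J)  ≡⟨ +-assoc (∑ h I) _ _ ⟩
      ∑ h I + (∑ (λ z → h (I Nat.+ z)) J + h (I Nat.+ J))  ≡⟨ cong (∑ h I +_) (sym (∑-suc _ J)) ⟩
      ∑ h I + ∑ (λ z → h (I Nat.+ z)) (suc J)            ∎
      where open ≡-Reasoning

    ∑-blocks : ∀ h k F → ∑ h (k Nat.* F) ≡ ∑ (λ d → ∑ (λ z → h (d Nat.* F Nat.+ z)) F) k
    ∑-blocks h zero F = refl
    ∑-blocks h (suc k) F = begin
      ∑ h (F Nat.+ k Nat.* F)                                  ≡⟨ cong (∑ h) (ℕₚ.+-comm F (k Nat.* F)) ⟩
      ∑ h (k Nat.* F Nat.+ F)                                  ≡⟨ ∑-split h (k Nat.* F) F ⟩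
      ∑ h (k Nat.* F) + ∑ (λ z → h (k Nat.* F Nat.+ z)) F        ≡⟨ cong (_+ ∑ (λ z → h (k Nat.* F Nat.+ z)) F) (∑-blocks h k F) ⟩
      ∑ (λ d → ∑ (λ z → h (d Nat.* F Nat.+ z)) F) k + ∑ (λ z → h (k Nat.* F Nat.+ z)) F ≡⟨ sym (∑-suc _ k) ⟩
      ∑ (λ d → ∑ (λ z → h (d Nat.* F Nat.+ z)) F) (suc k)      ∎
      where open ≡-Reasoning

    ∑-swap-triangle : ∀ (F : ℕ → ℕ → ℕ → A) I N →
      ∑ (λ i → ∑ (λ j₂ → ∑ (λ j₁ → F j₁ j₂ i) j₂) N) I ≡ ∑ (λ j₂ → ∑ (λ j₁ → ∑ (F j₁ j₂) I) j₂) N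
    ∑-swap-triangle F I N = begin
      ∑ (λ i → ∑ (λ j₂ → ∑ (λ j₁ → F j₁ j₂ i) j₂) N) I   ≡⟨ ∑-swap (λ i j₂ → ∑ (λ j₁ → F j₁ j₂ i) j₂) I N ⟩
      ∑ (λ j₂ → ∑ (λ i → ∑ (λ j₁ → F j₁ j₂ i) j₂) I) N   ≡⟨ ∑-cong N (λ j₂ → ∑-swap (λ i j₁ → F j₁ j₂ i) I j₂) ⟩
      ∑ (λ j₂ → ∑ (λ j₁ → ∑ (F j₁ j₂) I) j₂) N           ∎
      where open ≡-Reasoning

    ∑-product : ∀ h h' I J → ∑ (λ i → ∑ (λ j → h i * h' j) J) I ≡ ∑ h I * ∑ h' J
    ∑-product h h' I J = trans (∑-cong I (λ i → ∑-*ˡ (h i) h' J)) (∑-*ʳ (∑ h' J) h I)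

  -- Sums of natural numbers.  They are literally the sums sum (map h (upTo N))
  -- occurring in the definitions of X and sumX.
  open RangeSums ℕₚ.+-*-isCommutativeSemiring public

  open Nat using (_+_; _*_)

  ∑-const : ∀ k N → ∑ (λ _ → k) N ≡ N * k
  ∑-const k zero = refl
  ∑-const k (suc N) = trans (∑-suc _ N) (trans (cong (_+ k) (∑-const k N)) (ℕₚ.+-comm (N * k) k))

  δ : Bool → ℕ
  δ b = if b then 1 else 0

  δ-∧ : ∀ a b → δ (a ∧ b) ≡ δ a * δ b
  δ-∧ true b = sym (ℕₚ.+-identityʳ (δ b))
  δ-∧ false b = refl

  and-snoc : ∀ bs b → foldr _∧_ true (bs ++ [ b ]) ≡ foldr _∧_ true bs ∧ b
  and-snoc [] b = ∧-identityʳ b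
  and-snoc (true ∷ bs) b = and-snoc bs b
  and-snoc (false ∷ bs) b = refl

  or-snoc : ∀ bs b → foldr _∨_ false (bs ++ [ b ]) ≡ foldr _∨_ false bs ∨ b
  or-snoc [] b = ∨-identityʳ b
  or-snoc (true ∷ bs) b = refl
  or-snoc (false ∷ bs) b = or-snoc bs b

  all-upTo-suc : ∀ p N → all p (upTo (suc N)) ≡ all p (upTo N) ∧ p N
  all-upTo-suc p N = trans (cong (foldr _∧_ true) (map-upTo-suc p N)) (and-snoc (map p (upTo N)) (p N))

  any-upTo-suc : ∀ p N → any p (upTo (suc N)) ≡ any p (upTo N) ∨ p N
  any-upTo-suc p N = trans (cong (foldr _∨_ false) (map-upTo-suc p N)) (or-snoc (map p (upTo N)) (p N))

  -- First-hit decomposition: "some g < K satisfies p" is the disjoint union over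
  -- g < K of "g is the first index satisfying p".
  first-hit : ∀ (p : ℕ → Bool) K → ∑ (λ g → δ (p g ∧ all (not ∘ p) (upTo g))) K ≡ δ (any p (upTo K))
  first-hit p zero = refl
  first-hit p (suc K) = begin
    ∑ hit (suc K)                                     ≡⟨ ∑-suc hit K ⟩
    ∑ hit K + hit K                                   ≡⟨ cong (_+ hit K) (first-hit p K) ⟩
    δ (any p (upTo K)) + δ (p K ∧ all (not ∘ p) (upTo K))
        ≡⟨ cong (λ b → δ (any p (upTo K)) + δ (p K ∧ b)) (none-is-not-any K) ⟩
    δ (any p (upTo K)) + δ (p K ∧ not (any p (upTo K))) ≡⟨ disjoint-union (any p (upTo K)) (p K) ⟩
    δ (any p (upTo K) ∨ p K)                          ≡⟨ cong δ (sym (any-upTo-suc p K)) ⟩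
    δ (any p (upTo (suc K)))                          ∎
    where
    open ≡-Reasoning
    hit : ℕ → ℕ
    hit g = δ (p g ∧ all (not ∘ p) (upTo g))
    none-is-not-any : ∀ K → all (not ∘ p) (upTo K) ≡ not (any p (upTo K))
    none-is-not-any zero = refl
    none-is-not-any (suc K) = begin
      all (not ∘ p) (upTo (suc K))         ≡⟨ all-upTo-suc (not ∘ p) K ⟩
      all (not ∘ p) (upTo K) ∧ not (p K)   ≡⟨ cong (_∧ not (p K)) (none-is-not-any K) ⟩
      not (any p (upTo K)) ∧ not (p K)     ≡⟨ de-morgan (any p (upTo K)) (p K) ⟩
      not (any p (upTo K) ∨ p K)           ≡⟨ cong not (sym (any-upTo-suc p K)) ⟩
      not (any p (upTo (suc K)))           ∎
      where
      de-morgan : ∀ a b → not a ∧ not b ≡ not (a ∨ b)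
      de-morgan true b = refl
      de-morgan false b = refl
    disjoint-union : ∀ a b → δ a + δ (b ∧ not a) ≡ δ (a ∨ b)
    disjoint-union true true = refl
    disjoint-union true false = refl
    disjoint-union false true = refl
    disjoint-union false false = refl

  choose2 : ℕ → ℕ
  choose2 zero = 0
  choose2 (suc k) = choose2 k + k

  ∑-pairs : ∀ (G : ℕ → Bool) N →
    ∑ (λ j₂ → ∑ (λ j₁ → δ (G j₁) * δ (G j₂)) j₂) N ≡ choose2 (∑ (λ j → δ (G j)) N)
  ∑-pairs G zero = refl
  ∑-pairs G (suc N) = begin
    ∑ pairs (suc N)                      ≡⟨ ∑-suc pairs N ⟩
    ∑ pairs N + ∑ (λ j₁ → δ (G j₁) * δ (G N)) N ≡⟨ cong₂ _+_ (∑-pairs G N) (∑-*ʳ (δ (G N)) (λ j → δ (G j)) N) ⟩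
    choose2 s + s * δ (G N)              ≡⟨ choose2-step s (G N) ⟩
    choose2 (s + δ (G N))                ≡⟨ cong choose2 (sym (∑-suc _ N)) ⟩
    choose2 (∑ (λ j → δ (G j)) (suc N))  ∎
    where
    open ≡-Reasoning
    pairs : ℕ → ℕ
    pairs j₂ = ∑ (λ j₁ → δ (G j₁) * δ (G j₂)) j₂
    s : ℕ
    s = ∑ (λ j → δ (G j)) N
    choose2-step : ∀ s b → choose2 s + s * δ b ≡ choose2 (s + δ b)
    choose2-step s true = trans (cong (choose2 s +_) (ℕₚ.*-identityʳ s)) (cong choose2 (sym (ℕₚ.+-comm s 1)))
    choose2-step s false = trans (cong (choose2 s +_) (ℕₚ.*-zeroʳ s)) (trans (ℕₚ.+-identityʳ (choose2 s)) (cong choose2 (sym (ℕₚ.+-identityʳ s))))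

module MGonal where

  open import Defs using (bin; Legal; HasLegalBelow; IsMGonal)
  open import Data.Nat using (ℕ; zero; suc; _+_; _*_; _∸_; _^_; _<_; _≤_; z≤n; s≤s; NonZero; >-nonZero⁻¹; _<?_)
  open import Data.Nat.Properties
  open import Data.Nat.DivMod
  open import Data.Nat.Divisibility using (divides-refl)
  open import Data.Nat.Induction using (<-rec)
  open import Data.Nat.ListAction using (sum)
  open import Data.Nat.Tactic.RingSolver using (solve-∀)
  open import Data.List using (List; []; _∷_; _++_; [_]; map)
  open import Data.List.Relation.Unary.All as All using (All; []; _∷_)
  open import Data.List.Relation.Unary.AllPairs using (AllPairs; []; _∷_)
  import Data.List.Relation.Unary.AllPairs.Properties as AllPairsₚ
  import Data.List.Relation.Unary.All.Properties as Allₚ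
  open import Data.Nat.ListAction.Properties using (sum-++)
  open import Data.List.Properties using (map-++)
  open import Data.Product using (_×_; _,_; proj₁; proj₂)
  open import Data.Sum using (inj₁; inj₂)
  open import Data.Empty using (⊥-elim)
  open import Relation.Nullary using (yes; no)
  open import Relation.Binary.Definitions using (tri<; tri≈; tri>)
  open import Relation.Binary.PropositionalEquality using (_≡_; _≢_; refl; sym; trans; cong; cong₂; subst; subst₂; module ≡-Reasoning)

  quotient-of : ∀ d .{{_ : NonZero d}} r q → r < d → (r + q * d) / d ≡ q
  quotient-of d r q r<d = trans (+-distrib-/-∣ʳ r (divides-refl q)) (cong₂ _+_ (m<n⇒m/n≡0 r<d) (m*n/n≡m q d))

  remainder-of : ∀ d .{{_ : NonZero d}} r q → r < d → (r + q * d) % d ≡ r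
  remainder-of d r q r<d = trans ([m+kn]%n≡m%n r q d) (m<n⇒m%n≡m r<d)

  module Explicit (m : ℕ) .{{_ : NonZero m}} where

    0<m : 0 < m
    0<m = >-nonZero⁻¹ m

    -- The base of the digit expansion underlying the m-gonal sequence.
    M : ℕ
    M = suc m

    f : ℕ → ℕ
    f zero = 1
    f (suc i) = 2 * suc (i % m) * M ^ (i / m)

    f-digits : ∀ q r → r < m → f (suc (r + q * m)) ≡ 2 * suc r * M ^ q
    f-digits q r r<m rewrite remainder-of m r q r<m | quotient-of m r q r<m = refl

    f-bin-start : ∀ q → f (suc (m * q)) ≡ 2 * M ^ q
    f-bin-start q = begin
      f (suc (m * q))          ≡⟨ cong (λ t → f (suc t)) (*-comm m q) ⟩
      f (suc (0 + q * m))      ≡⟨ f-digits q 0 0<m ⟩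
      2 * 1 * M ^ q            ≡⟨ cong (_* M ^ q) (*-identityʳ 2) ⟩
      2 * M ^ q                ∎
      where open ≡-Reasoning

    binStart : ℕ → ℕ
    binStart zero = 0
    binStart (suc k) = suc (m * k)

    bin-binStart : ∀ k → bin m (binStart k) ≡ k
    bin-binStart zero = refl
    bin-binStart (suc k) = cong suc (trans (cong (_/ m) (*-comm m k)) (m*n/n≡m k m))

    binStart-bin≤ : ∀ i → binStart (bin m i) ≤ i
    binStart-bin≤ zero = z≤n
    binStart-bin≤ (suc j) = s≤s (subst (_≤ j) (*-comm (j / m) m) (m/n*n≤m j m))

    <binStart-next : ∀ i → i < binStart (suc (bin m i))
    <binStart-next zero = s≤s z≤n
    <binStart-next (suc j) = s≤s (begin-strict
      j                       ≡⟨ m≡m%n+[m/n]*n j m ⟩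
      j % m + j / m * m       <⟨ +-monoˡ-< (j / m * m) (m%n<n j m) ⟩
      m + j / m * m           ≡⟨ cong (m +_) (*-comm (j / m) m) ⟩
      m + m * (j / m)         ≡⟨ *-suc m (j / m) ⟨
      m * suc (j / m)         ∎)
      where open ≤-Reasoning

    bin-mono : ∀ {i j} → i ≤ j → bin m i ≤ bin m j
    bin-mono {zero} _ = z≤n
    bin-mono {suc i} {suc j} (s≤s p) = s≤s (/-monoˡ-≤ m p)

    binStart-mono : ∀ {k k'} → k ≤ k' → binStart k ≤ binStart k'
    binStart-mono {zero} _ = z≤n
    binStart-mono {suc k} {suc k'} (s≤s p) = s≤s (*-monoʳ-≤ m p)

    binStart≤⇒≤bin : ∀ {c y} → binStart c ≤ y → c ≤ bin m y
    binStart≤⇒≤bin {c} p = subst (_≤ _) (bin-binStart c) (bin-mono p)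

    ≤bin⇒binStart≤ : ∀ {c y} → c ≤ bin m y → binStart c ≤ y
    ≤bin⇒binStart≤ {c} {y} p = ≤-trans (binStart-mono p) (binStart-bin≤ y)

    bin-< : ∀ {x y} → x < y → bin m x ≢ bin m y → suc (bin m x) ≤ bin m y
    bin-< x<y ne = ≤∧≢⇒< (bin-mono (<⇒≤ x<y)) ne

    -- The defining recursion of the m-gonal sequence in closed form:
    -- a_{i+1} = a_i + a_{binStart (bin i)}, the first term of the bin of i.
    f-step : ∀ i → f (suc i) ≡ f i + f (binStart (bin m i))
    f-step zero = f-digits 0 0 0<m
    f-step (suc j) = step (j % m) (j / m) (m%n<n j m) (m≡m%n+[m/n]*n j m)
      where
      open ≡-Reasoning
      rhs : ∀ r q → r < m → f (suc (r + q * m)) + f (binStart (bin m (suc (r + q * m)))) ≡ 2 * suc r * M ^ q + 2 * M ^ q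
      rhs r q r<m = cong₂ _+_ (f-digits q r r<m) (trans (cong (λ t → f (suc (m * t))) (quotient-of m r q r<m)) (f-bin-start q))
      step : ∀ r q → r < m → j ≡ r + q * m → f (suc (suc j)) ≡ f (suc j) + f (binStart (bin m (suc j)))
      step r q r<m refl with m≤n⇒m<n∨m≡n r<m
      ... | inj₁ r+1<m = begin
            f (suc (suc r + q * m))               ≡⟨ f-digits q (suc r) r+1<m ⟩
            2 * suc (suc r) * M ^ q               ≡⟨ next-in-bin r (M ^ q) ⟩
            2 * suc r * M ^ q + 2 * M ^ q         ≡⟨ sym (rhs r q r<m) ⟩
            f (suc (r + q * m)) + f (binStart (bin m (suc (r + q * m)))) ∎
        where
        next-in-bin : ∀ r p → 2 * suc (suc r) * p ≡ 2 * suc r * p + 2 * p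
        next-in-bin = solve-∀
      ... | inj₂ r+1≡m = begin
            f (suc (suc r + q * m))               ≡⟨ cong (λ t → f (suc (t + q * m))) r+1≡m ⟩
            f (suc (suc q * m))                   ≡⟨ cong (λ t → f (suc t)) (*-comm (suc q) m) ⟩
            f (suc (m * suc q))                   ≡⟨ f-bin-start (suc q) ⟩
            2 * (M * M ^ q)                       ≡⟨ cong (λ t → 2 * (suc t * M ^ q)) (sym r+1≡m) ⟩
            2 * (suc (suc r) * M ^ q)             ≡⟨ next-bin r (M ^ q) ⟩
            2 * suc r * M ^ q + 2 * M ^ q         ≡⟨ sym (rhs r q r<m) ⟩
            f (suc (r + q * m)) + f (binStart (bin m (suc (r + q * m)))) ∎
        where
        next-bin : ∀ r p → 2 * (suc (suc r) * p) ≡ 2 * suc r * p + 2 * p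
        next-bin = solve-∀

    f-pos : ∀ i → 0 < f i
    f-pos zero = s≤s z≤n
    f-pos (suc i) = subst (0 <_) (sym (f-step i)) (≤-trans (f-pos i) (m≤m+n (f i) _))

    f-<suc : ∀ i → f i < f (suc i)
    f-<suc i = subst (f i <_) (sym (f-step i)) (m<m+n (f i) (f-pos (binStart (bin m i))))

    f-mono : ∀ {i j} → i ≤ j → f i ≤ f j
    f-mono {j = zero} z≤n = ≤-refl
    f-mono {i} {suc j} i≤1+j with m≤n⇒m<n∨m≡n i≤1+j
    ... | inj₁ i<1+j = ≤-trans (f-mono (≤-pred i<1+j)) (<⇒≤ (f-<suc j))
    ... | inj₂ refl = ≤-refl

    f-head-bound : ∀ b x → binStart b ≤ x → f x + f (binStart b) ≤ f (suc x)
    f-head-bound b x b≤x = subst (f x + f (binStart b) ≤_) (sym (f-step x))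
      (+-monoʳ-≤ (f x) (f-mono (binStart-mono (binStart≤⇒≤bin b≤x))))

    sumf : List ℕ → ℕ
    sumf L = sum (map f L)

    -- Maximality of the greedy sums: a legal sum using only indices in
    -- [binStart b, i) stays below f i − f (binStart b).  For b = 0 this says every
    -- legal sum of indices below i is smaller than f i.
    legal-sum-bound : ∀ b i (L : List ℕ) → binStart b ≤ i → AllPairs _<_ L
      → AllPairs (λ x y → bin m x ≢ bin m y) L
      → All (λ y → binStart b ≤ y × y < i) L → sumf L + f (binStart b) ≤ f i
    legal-sum-bound b i [] b≤i _ _ _ = f-mono b≤i
    legal-sum-bound b i (x ∷ []) _ _ _ ((b≤x , x<i) ∷ []) = begin
      (f x + 0) + f (binStart b)   ≡⟨ cong (_+ f (binStart b)) (+-identityʳ (f x)) ⟩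
      f x + f (binStart b)         ≤⟨ f-head-bound b x b≤x ⟩
      f (suc x)                    ≤⟨ f-mono x<i ⟩
      f i                          ∎
      where open ≤-Reasoning
    legal-sum-bound b i (x ∷ rest@(_ ∷ _)) _ (x<rest ∷ inc) (x≁rest ∷ dist) ((b≤x , _) ∷ win) = begin
      (f x + sumf rest) + f (binStart b)   ≡⟨ swap-last (f x) (sumf rest) (f (binStart b)) ⟩
      (f x + f (binStart b)) + sumf rest   ≤⟨ +-monoˡ-≤ (sumf rest) (f-head-bound b x b≤x) ⟩
      f (suc x) + sumf rest                ≤⟨ +-monoˡ-≤ (sumf rest) (f-mono (<binStart-next x)) ⟩
      f (binStart b') + sumf rest          ≡⟨ +-comm _ (sumf rest) ⟩
      sumf rest + f (binStart b')          ≤⟨ legal-sum-bound b' i rest b'≤i inc dist win' ⟩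
      f i                                  ∎
      where
      open ≤-Reasoning
      b' : ℕ
      b' = suc (bin m x)
      swap-last : ∀ a c d → (a + c) + d ≡ (a + d) + c
      swap-last = solve-∀
      shift : ∀ {ys} → All (x <_) ys → All (λ y → bin m x ≢ bin m y) ys
            → All (λ y → binStart b ≤ y × y < i) ys → All (λ y → binStart b' ≤ y × y < i) ys
      shift [] [] [] = []
      shift (p ∷ ps) (d ∷ ds) ((_ , q) ∷ qs) = (≤bin⇒binStart≤ (bin-< p d) , q) ∷ shift ps ds qs
      win' : All (λ y → binStart b' ≤ y × y < i) rest
      win' = shift x<rest x≁rest win
      b'≤i : binStart b' ≤ i
      b'≤i with win'
      ... | (b'≤y , y<i) ∷ _ = ≤-trans b'≤y (<⇒≤ y<i)

    extend-legal : ∀ j z → HasLegalBelow m f (binStart (bin m j)) z → HasLegalBelow m f (suc j) (z + f j)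
    extend-legal j z (L , below , inc , dist , sum≡z) =
        L ++ [ j ]
      , Allₚ.++⁺ (All.map (λ y< → <-≤-trans y< (≤-trans (binStart-bin≤ j) (n≤1+n j))) below) (≤-refl ∷ [])
      , AllPairsₚ.++⁺ inc ([] ∷ []) (All.map (λ y< → <-≤-trans y< (binStart-bin≤ j) ∷ []) below)
      , AllPairsₚ.++⁺ dist ([] ∷ []) (All.map (λ y< → other-bin y< ∷ []) below)
      , sum-eq
      where
      other-bin : ∀ {y} → y < binStart (bin m j) → bin m y ≢ bin m j
      other-bin y< e = <⇒≱ y< (≤bin⇒binStart≤ (≤-reflexive (sym e)))
      open ≡-Reasoning
      sum-eq : sumf (L ++ [ j ]) ≡ z + f j
      sum-eq = begin
        sum (map f (L ++ [ j ]))     ≡⟨ cong sum (map-++ f L [ j ]) ⟩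
        sum (map f L ++ [ f j ])     ≡⟨ sum-++ (map f L) [ f j ] ⟩
        sumf L + (f j + 0)           ≡⟨ cong₂ _+_ sum≡z (+-identityʳ (f j)) ⟩
        z + f j                      ∎

    -- Existence (greedy algorithm): every z < f i has a legal decomposition with
    -- respect to f using only indices below i.
    representable : ∀ i z → z < f i → HasLegalBelow m f i z
    representable = <-rec (λ i → ∀ z → z < f i → HasLegalBelow m f i z) step
      where
      widen : ∀ {j z} → HasLegalBelow m f j z → HasLegalBelow m f (suc j) z
      widen (L , below , legal) = L , All.map m<n⇒m<1+n below , legal
      step : ∀ i → (∀ {k} → k < i → ∀ z → z < f k → HasLegalBelow m f k z) → ∀ z → z < f i → HasLegalBelow m f i z
      step zero _ zero _ = [] , [] , [] , [] , refl
      step zero _ (suc z) (s≤s ())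
      step (suc j) rec z z<f with z <? f j
      ... | yes z<fj = widen (rec (n<1+n j) z z<fj)
      ... | no z≮fj = subst (HasLegalBelow m f (suc j)) (m∸n+n≡m fj≤z)
            (extend-legal j (z ∸ f j) (rec (s≤s (binStart-bin≤ j)) (z ∸ f j) rest<))
        where
        fj≤z : f j ≤ z
        fj≤z = ≮⇒≥ z≮fj
        rest< : z ∸ f j < f (binStart (bin m j))
        rest< = +-cancelˡ-< (f j) _ _ (subst₂ _<_ (sym (m+[n∸m]≡n fj≤z)) (f-step j) z<f)

    module Agreeing (a : ℕ → ℕ) {i : ℕ} (agree : ∀ j → j < i → a j ≡ f j) where

      sum-agree : ∀ L → All (_< i) L → sum (map a L) ≡ sumf L
      sum-agree [] [] = refl
      sum-agree (x ∷ L) (x<i ∷ below) = cong₂ _+_ (agree x x<i) (sum-agree L below)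

      to-f : ∀ {z} → HasLegalBelow m a i z → HasLegalBelow m f i z
      to-f (L , below , inc , dist , s) = L , below , inc , dist , trans (sym (sum-agree L below)) s

      from-f : ∀ {z} → HasLegalBelow m f i z → HasLegalBelow m a i z
      from-f (L , below , inc , dist , s) = L , below , inc , dist , trans (sum-agree L below) s

    mgonal-closed-form : ∀ (a : ℕ → ℕ) → IsMGonal m a → ∀ i → a i ≡ f i
    mgonal-closed-form a isM = <-rec (λ i → a i ≡ f i) (λ i ih → step i (λ j j<i → ih j<i))
      where
      step : ∀ i → (∀ j → j < i → a j ≡ f j) → a i ≡ f i
      step i agree with <-cmp (a i) (f i)
      ... | tri≈ _ e _ = e
      ... | tri< a<f _ _ = ⊥-elim (proj₁ (proj₂ (isM i)) (from-f (representable i (a i) a<f)))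
        where open Agreeing a agree
      ... | tri> _ _ f<a with to-f (proj₂ (proj₂ (isM i)) (f i) (f-pos i) f<a)
        where open Agreeing a agree
      ...   | L , below , inc , dist , sum≡fi =
              ⊥-elim (<-irrefl refl (subst (_≤ f i) (trans (+-comm (sumf L) 1) (cong suc sum≡fi))
                (legal-sum-bound 0 i L z≤n inc dist (All.map (z≤n ,_) below))))

module SummandCount where

  open import Defs using (bin)
  open MGonal using (quotient-of; remainder-of; module Explicit)
  open import Data.Nat using (ℕ; zero; suc; _+_; _*_; _∸_; _^_; _<_; _≤_; z≤n; s≤s; NonZero)
  open import Data.Nat.Properties
  open import Data.Nat.DivMod
  open import Data.Nat.Divisibility using (_∣_; divides; ∣m∣n⇒∣m+n)
  open import Data.Nat.Tactic.RingSolver using (solve-∀)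
  open import Data.List using (List; []; _∷_; length)
  open import Data.List.Relation.Unary.All using (All; []; _∷_)
  open import Data.List.Relation.Unary.AllPairs using (AllPairs; []; _∷_)
  open import Data.Sum using (inj₁; inj₂)
  open import Relation.Binary.PropositionalEquality using (_≡_; _≢_; refl; sym; trans; cong; cong₂; subst; module ≡-Reasoning)

  nonzero : ℕ → ℕ
  nonzero zero = 0
  nonzero (suc _) = 1

  module Digits (m : ℕ) .{{_ : NonZero m}} where
    open Explicit m

    nonzeroDigitsFuel : ℕ → ℕ → ℕ
    nonzeroDigitsFuel zero w = 0
    nonzeroDigitsFuel (suc k) w = nonzero (w % M) + nonzeroDigitsFuel k (w / M)

    -- Fuel w suffices since the number has fewer than w + 1 digits.
    nonzeroDigits : ℕ → ℕ
    nonzeroDigits w = nonzeroDigitsFuel w w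

    -- The base is at least 2, so dropping a digit shrinks a positive number.
    1<M : 1 < M
    1<M = s≤s 0<m

    fuel-zero : ∀ k → nonzeroDigitsFuel k 0 ≡ 0
    fuel-zero zero = refl
    fuel-zero (suc k) = fuel-zero k

    fuel-irrelevant : ∀ k k' w → w ≤ k → w ≤ k' → nonzeroDigitsFuel k w ≡ nonzeroDigitsFuel k' w
    fuel-irrelevant k k' zero _ _ = trans (fuel-zero k) (sym (fuel-zero k'))
    fuel-irrelevant (suc k) (suc k') (suc w) (s≤s w≤k) (s≤s w≤k') =
      cong (nonzero (suc w % M) +_) (fuel-irrelevant k k' (suc w / M) (≤-trans shrink w≤k) (≤-trans shrink w≤k'))
      where
      shrink : suc w / M ≤ w
      shrink = ≤-pred (m/n<m (suc w) M 1<M)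

    nonzeroDigits-step : ∀ r w → r < M → nonzeroDigits (r + w * M) ≡ nonzero r + nonzeroDigits w
    nonzeroDigits-step r w r<M with r + w * M in eq
    ... | zero with m+n≡0⇒m≡0 r eq | m*n≡0⇒m≡0∨n≡0 w (m+n≡0⇒n≡0 r eq)
    ...   | refl | inj₁ refl = refl
    ...   | refl | inj₂ ()
    nonzeroDigits-step r w r<M | suc k = begin
      nonzero (suc k % M) + nonzeroDigitsFuel k (suc k / M)
        ≡⟨ cong (λ v → nonzero (v % M) + nonzeroDigitsFuel k (v / M)) (sym eq) ⟩
      nonzero ((r + w * M) % M) + nonzeroDigitsFuel k ((r + w * M) / M)
        ≡⟨ cong₂ (λ u v → nonzero u + nonzeroDigitsFuel k v) (remainder-of M r w r<M) (quotient-of M r w r<M) ⟩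
      nonzero r + nonzeroDigitsFuel k w
        ≡⟨ cong (nonzero r +_) (fuel-irrelevant k w w w≤k ≤-refl) ⟩
      nonzero r + nonzeroDigits w ∎
      where
      open ≡-Reasoning
      w≤k : w ≤ k
      w≤k = ≤-pred (subst (_< suc k) (trans (cong (_/ M) (sym eq)) (quotient-of M r w r<M)) (m/n<m (suc k) M 1<M))

    nonzeroDigits-pow : ∀ q w → nonzeroDigits (M ^ q * w) ≡ nonzeroDigits w
    nonzeroDigits-pow zero w = cong nonzeroDigits (+-identityʳ w)
    nonzeroDigits-pow (suc q) w = begin
      nonzeroDigits (M * M ^ q * w)     ≡⟨ cong nonzeroDigits (trans (*-assoc M (M ^ q) w) (*-comm M _)) ⟩
      nonzeroDigits (0 + M ^ q * w * M) ≡⟨ nonzeroDigits-step 0 (M ^ q * w) (s≤s z≤n) ⟩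
      nonzeroDigits (M ^ q * w)         ≡⟨ nonzeroDigits-pow q w ⟩
      nonzeroDigits w                   ∎
      where open ≡-Reasoning

    nonzeroDigits-lead : ∀ n w d → w < M ^ n → d < M → nonzeroDigits (w + d * M ^ n) ≡ nonzeroDigits w + nonzero d
    nonzeroDigits-lead zero zero d _ d<M = begin
      nonzeroDigits (d * 1)          ≡⟨ cong nonzeroDigits (trans (*-identityʳ d) (sym (+-identityʳ d))) ⟩
      nonzeroDigits (d + 0 * M)      ≡⟨ nonzeroDigits-step d 0 d<M ⟩
      nonzero d + 0                  ≡⟨ +-comm (nonzero d) 0 ⟩
      0 + nonzero d                  ∎
      where open ≡-Reasoning
    nonzeroDigits-lead zero (suc w) d (s≤s ()) _
    nonzeroDigits-lead (suc n) w d w< d<M = begin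
      nonzeroDigits (w + d * M ^ suc n)            ≡⟨ cong nonzeroDigits regroup ⟩
      nonzeroDigits (r + (q + d * M ^ n) * M)      ≡⟨ nonzeroDigits-step r (q + d * M ^ n) (m%n<n w M) ⟩
      nonzero r + nonzeroDigits (q + d * M ^ n)    ≡⟨ cong (nonzero r +_) (nonzeroDigits-lead n q d q< d<M) ⟩
      nonzero r + (nonzeroDigits q + nonzero d)    ≡⟨ +-assoc (nonzero r) _ _ ⟨
      (nonzero r + nonzeroDigits q) + nonzero d    ≡⟨ cong (_+ nonzero d) (nonzeroDigits-step r q (m%n<n w M)) ⟨
      nonzeroDigits (r + q * M) + nonzero d        ≡⟨ cong (λ v → nonzeroDigits v + nonzero d) (m≡m%n+[m/n]*n w M) ⟨
      nonzeroDigits w + nonzero d                  ∎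
      where
      open ≡-Reasoning
      r : ℕ
      r = w % M
      q : ℕ
      q = w / M
      q< : q < M ^ n
      q< = m<n*o⇒m/o<n (subst (w <_) (*-comm M (M ^ n)) w<)
      shape : ∀ r q d p m → r + q * suc m + d * (suc m * p) ≡ r + (q + d * p) * suc m
      shape = solve-∀
      regroup : w + d * M ^ suc n ≡ r + (q + d * M ^ n) * M
      regroup = trans (cong (_+ d * M ^ suc n) (m≡m%n+[m/n]*n w M)) (shape r q d (M ^ n) m)

    -- The number of summands of z: the parity bit (the summand a₀ = 1) plus the
    -- nonzero base-(m+1) digits of ⌊z/2⌋ (one summand per nonzero digit).
    summands : ℕ → ℕ
    summands z = z % 2 + nonzeroDigits (z / 2)

    summands-split : ∀ e w → e < 2 → summands (e + w * 2) ≡ e + nonzeroDigits w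
    summands-split e w e<2 = cong₂ (λ u v → u + nonzeroDigits v) (remainder-of 2 e w e<2) (quotient-of 2 e w e<2)

    -- |I_n| = a_{mn+1} = 2 (m+1)^n.
    F : ℕ → ℕ
    F n = 2 * M ^ n

    -- Adding d · F n to z < F n adds the summand of index m·n + d when d ≠ 0.
    summands-lead : ∀ n z d → z < F n → d < M → summands (d * F n + z) ≡ summands z + nonzero d
    summands-lead n z d z< d< = begin
      summands (d * F n + z)                      ≡⟨ cong summands regroup ⟩
      summands (e + (w + d * M ^ n) * 2)          ≡⟨ summands-split e (w + d * M ^ n) (m%n<n z 2) ⟩
      e + nonzeroDigits (w + d * M ^ n)           ≡⟨ cong (e +_) (nonzeroDigits-lead n w d w< d<) ⟩
      e + (nonzeroDigits w + nonzero d)           ≡⟨ +-assoc e _ _ ⟨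
      (e + nonzeroDigits w) + nonzero d           ≡⟨ cong (_+ nonzero d) (summands-split e w (m%n<n z 2)) ⟨
      summands (e + w * 2) + nonzero d            ≡⟨ cong (λ v → summands v + nonzero d) (m≡m%n+[m/n]*n z 2) ⟨
      summands z + nonzero d                      ∎
      where
      open ≡-Reasoning
      e : ℕ
      e = z % 2
      w : ℕ
      w = z / 2
      w< : w < M ^ n
      w< = m<n*o⇒m/o<n (subst (z <_) (*-comm 2 (M ^ n)) z<)
      shape : ∀ e w d p → d * (2 * p) + (e + w * 2) ≡ e + (w + d * p) * 2
      shape = solve-∀
      regroup : d * F n + z ≡ e + (w + d * M ^ n) * 2
      regroup = trans (cong (d * F n +_) (m≡m%n+[m/n]*n z 2)) (shape e w d (M ^ n))

    f-multiple : ∀ b y → suc b ≤ bin m y → 2 * M ^ b ∣ f y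
    f-multiple b (suc j) (s≤s b≤q) = divides (suc (j % m) * M ^ (j / m ∸ b)) (begin
      2 * suc (j % m) * M ^ (j / m)                   ≡⟨ cong (λ e → 2 * suc (j % m) * M ^ e) (m+[n∸m]≡n b≤q) ⟨
      2 * suc (j % m) * M ^ (b + (j / m ∸ b))         ≡⟨ cong (2 * suc (j % m) *_) (^-distribˡ-+-* M b (j / m ∸ b)) ⟩
      2 * suc (j % m) * (M ^ b * M ^ (j / m ∸ b))     ≡⟨ shape (suc (j % m)) (M ^ b) (M ^ (j / m ∸ b)) ⟩
      suc (j % m) * M ^ (j / m ∸ b) * (2 * M ^ b)     ∎)
      where
      open ≡-Reasoning
      shape : ∀ s p q → 2 * s * (p * q) ≡ s * q * (2 * p)
      shape = solve-∀

    sum-multiple : ∀ b (L : List ℕ) → All (λ y → suc b ≤ bin m y) L → 2 * M ^ b ∣ sumf L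
    sum-multiple b [] [] = divides 0 refl
    sum-multiple b (y ∷ L) (p ∷ ps) = ∣m∣n⇒∣m+n (f-multiple b y p) (sum-multiple b L ps)

    summands-head : ∀ x t → summands (f x + t * (2 * M ^ bin m x)) ≡ suc (summands (t * (2 * M ^ bin m x)))
    summands-head zero t = trans (summands-split 1 t (s≤s (s≤s z≤n))) (cong suc (sym (summands-split 0 t (s≤s z≤n))))
    summands-head (suc j) t = begin
      summands (2 * suc r * P + t * (2 * (M * P)))   ≡⟨ cong summands (shape₁ r t P m) ⟩
      summands (0 + (P * (suc r + t * M)) * 2)       ≡⟨ summands-split 0 (P * (suc r + t * M)) (s≤s z≤n) ⟩
      nonzeroDigits (P * (suc r + t * M))            ≡⟨ nonzeroDigits-pow q _ ⟩
      nonzeroDigits (suc r + t * M)                  ≡⟨ nonzeroDigits-step (suc r) t (s≤s (m%n<n j m)) ⟩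
      suc (nonzeroDigits t)                          ≡⟨ cong suc (nonzeroDigits-pow (suc q) t) ⟨
      suc (nonzeroDigits (M * P * t))                ≡⟨ cong suc (summands-split 0 (M * P * t) (s≤s z≤n)) ⟨
      suc (summands (0 + (M * P * t) * 2))           ≡⟨ cong (λ v → suc (summands v)) (shape₂ t P m) ⟨
      suc (summands (t * (2 * (M * P))))             ∎
      where
      open ≡-Reasoning
      r : ℕ
      r = j % m
      q : ℕ
      q = j / m
      P : ℕ
      P = M ^ q
      shape₁ : ∀ r t p m → 2 * suc r * p + t * (2 * (suc m * p)) ≡ 0 + (p * (suc r + t * suc m)) * 2
      shape₁ = solve-∀
      shape₂ : ∀ t p m → t * (2 * (suc m * p)) ≡ 0 + (suc m * p * t) * 2
      shape₂ = solve-∀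

    length-legal : ∀ L → AllPairs _<_ L → AllPairs (λ x y → bin m x ≢ bin m y) L → length L ≡ summands (sumf L)
    length-legal [] _ _ = refl
    length-legal (x ∷ rest) (x<rest ∷ inc) (x≁rest ∷ dist) with sum-multiple (bin m x) rest (later x<rest x≁rest)
      where
      later : ∀ {ys} → All (x <_) ys → All (λ y → bin m x ≢ bin m y) ys → All (λ y → suc (bin m x) ≤ bin m y) ys
      later [] [] = []
      later (p ∷ ps) (d ∷ ds) = bin-< p d ∷ later ps ds
    ... | divides t rest≡ = begin
      suc (length rest)                               ≡⟨ cong suc (length-legal rest inc dist) ⟩
      suc (summands (sumf rest))                      ≡⟨ cong (λ v → suc (summands v)) rest≡ ⟩
      suc (summands (t * (2 * M ^ bin m x)))          ≡⟨ summands-head x t ⟨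
      summands (f x + t * (2 * M ^ bin m x))          ≡⟨ cong (λ v → summands (f x + v)) rest≡ ⟨
      summands (f x + sumf rest)                      ∎
      where open ≡-Reasoning

module Moments where

  open Sums using (∑; ∑-cong; ∑-cong<; ∑-shift; ∑-const; ∑-zero; ∑-+; ∑-*ˡ; ∑-blocks; choose2)
  open MGonal using (module Explicit)
  open SummandCount using (nonzero; module Digits)
  open import Data.Nat using (ℕ; zero; suc; _+_; _*_; _^_; pred; NonZero)
  open import Data.Nat.Properties
  open import Data.Nat.Tactic.RingSolver using (solve-∀)
  open import Function using (_∘_)
  open import Relation.Binary.PropositionalEquality using (_≡_; refl; sym; trans; cong; cong₂; module ≡-Reasoning)

  module SummandMoments (m : ℕ) .{{_ : NonZero m}} where
    open Explicit m using (M)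
    open Digits m using (summands; summands-lead; F)

    moment : (ℕ → ℕ) → ℕ → ℕ
    moment h n = ∑ (λ z → h (summands z)) (F n)

    -- I_{n+1} consists of m + 1 translates d · |I_n| + I_n; the translate with
    -- d ≠ 0 adds exactly one summand (that of index m·n + d).
    moment-step : ∀ h n → moment h (suc n) ≡ moment h n + m * moment (h ∘ suc) n
    moment-step h n = begin
      ∑ (λ z → h (summands z)) (2 * (M * M ^ n))                   ≡⟨ cong (∑ (λ z → h (summands z))) (blocks m (M ^ n)) ⟩
      ∑ (λ z → h (summands z)) (M * F n)                           ≡⟨ ∑-blocks (λ z → h (summands z)) M (F n) ⟩
      ∑ (λ d → ∑ (λ z → h (summands (d * F n + z))) (F n)) M       ≡⟨ ∑-cong< M (λ d d< → ∑-cong< (F n) (λ z z< → cong h (summands-lead n z d z< d<))) ⟩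
      ∑ (λ d → ∑ (λ z → h (summands z + nonzero d)) (F n)) M       ≡⟨ ∑-shift _ m ⟩
      ∑ (λ z → h (summands z + 0)) (F n) + ∑ (λ _ → ∑ (λ z → h (summands z + 1)) (F n)) m
          ≡⟨ cong₂ _+_ (∑-cong (F n) (λ z → cong h (+-identityʳ (summands z)))) (∑-const _ m) ⟩
      moment h n + m * ∑ (λ z → h (summands z + 1)) (F n)          ≡⟨ cong (λ v → moment h n + m * v) (∑-cong (F n) (λ z → cong h (+-comm (summands z) 1))) ⟩
      moment h n + m * moment (h ∘ suc) n                          ∎
      where
      open ≡-Reasoning
      blocks : ∀ m p → 2 * (suc m * p) ≡ suc m * (2 * p)
      blocks = solve-∀

    -- D n = 2 (m + 1) μ_n: twice the mean number of summands, scaled by m + 1.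
    D : ℕ → ℕ
    D n = 2 * n * m + M

    isZero : ℕ → ℕ
    isZero zero = 1
    isZero (suc _) = 0

    -- Number of pairs of gaps in a decomposition with k summands.
    gapPairs : ℕ → ℕ
    gapPairs k = choose2 (pred k)

    moment-suc : ∀ n → moment suc n ≡ moment (λ k → k) n + F n * 1
    moment-suc n = trans (∑-cong (F n) (λ z → +-comm 1 (summands z)))
                   (trans (∑-+ summands (λ _ → 1) (F n)) (cong (moment (λ k → k) n +_) (∑-const 1 (F n))))

    first-moment : ∀ n → M * moment (λ k → k) n ≡ M ^ n * D n
    first-moment zero = trans (*-identityʳ M) (sym (+-identityʳ M))
    first-moment (suc n) = begin
      M * S₁ (suc n)                                      ≡⟨ cong (M *_) (trans (moment-step (λ k → k) n) (cong (λ v → S₁ n + m * v) (moment-suc n))) ⟩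
      M * (S₁ n + m * (S₁ n + 2 * M ^ n * 1))             ≡⟨ expand (S₁ n) (M ^ n) m ⟩
      M * S₁ n + m * (M * S₁ n) + 2 * m * M * M ^ n       ≡⟨ cong (λ X → X + m * X + 2 * m * M * M ^ n) (first-moment n) ⟩
      M ^ n * D n + m * (M ^ n * D n) + 2 * m * M * M ^ n ≡⟨ collect (M ^ n) n m ⟩
      M ^ suc n * D (suc n)                               ∎
      where
      open ≡-Reasoning
      S₁ : ℕ → ℕ
      S₁ = moment (λ k → k)
      expand : ∀ s P m → suc m * (s + m * (s + 2 * P * 1)) ≡ suc m * s + m * (suc m * s) + 2 * m * suc m * P
      expand = solve-∀
      collect : ∀ P n m → P * (2 * n * m + suc m) + m * (P * (2 * n * m + suc m)) + 2 * m * suc m * P ≡ suc m * P * (2 * suc n * m + suc m)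
      collect = solve-∀

    moment-suc² : ∀ n → moment (λ k → suc k * suc k) n ≡ moment (λ k → k * k) n + 2 * moment (λ k → k) n + F n * 1
    moment-suc² n = begin
      ∑ (λ z → suc (c z) * suc (c z)) (F n)               ≡⟨ ∑-cong (F n) (λ z → square (c z)) ⟩
      ∑ (λ z → (c z * c z + 2 * c z) + 1) (F n)           ≡⟨ ∑-+ _ _ (F n) ⟩
      ∑ (λ z → c z * c z + 2 * c z) (F n) + ∑ (λ _ → 1) (F n) ≡⟨ cong₂ _+_ (∑-+ _ _ (F n)) (∑-const 1 (F n)) ⟩
      moment (λ k → k * k) n + ∑ (λ z → 2 * c z) (F n) + F n * 1 ≡⟨ cong (λ v → moment (λ k → k * k) n + v + F n * 1) (∑-*ˡ 2 c (F n)) ⟩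
      moment (λ k → k * k) n + 2 * moment (λ k → k) n + F n * 1 ∎
      where
      open ≡-Reasoning
      c : ℕ → ℕ
      c = summands
      square : ∀ k → suc k * suc k ≡ k * k + 2 * k + 1
      square = solve-∀

    second-moment : ∀ n → 2 * M * M * moment (λ k → k * k) n ≡ M ^ n * (4 * n * m + M * M + D n * D n)
    second-moment zero = base m
      where
      base : ∀ m → 2 * suc m * suc m * 1 ≡ 1 * (4 * 0 * m + suc m * suc m + (2 * 0 * m + suc m) * (2 * 0 * m + suc m))
      base = solve-∀
    second-moment (suc n) = begin
      2 * M * M * S₂ (suc n)
          ≡⟨ cong (2 * M * M *_) (trans (moment-step (λ k → k * k) n) (cong (λ v → S₂ n + m * v) (moment-suc² n))) ⟩
      2 * M * M * (S₂ n + m * (S₂ n + 2 * S₁ n + 2 * M ^ n * 1))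
          ≡⟨ expand (S₂ n) (S₁ n) (M ^ n) m ⟩
      M * (2 * M * M * S₂ n) + 4 * m * M * (M * S₁ n) + 4 * m * M * M * M ^ n
          ≡⟨ cong₂ (λ X Y → M * X + 4 * m * M * Y + 4 * m * M * M * M ^ n) (second-moment n) (first-moment n) ⟩
      M * (M ^ n * (4 * n * m + M * M + D n * D n)) + 4 * m * M * (M ^ n * D n) + 4 * m * M * M * M ^ n
          ≡⟨ collect (M ^ n) n m ⟩
      M ^ suc n * (4 * suc n * m + M * M + D (suc n) * D (suc n)) ∎
      where
      open ≡-Reasoning
      S₁ : ℕ → ℕ
      S₁ = moment (λ k → k)
      S₂ : ℕ → ℕ
      S₂ = moment (λ k → k * k)
      expand : ∀ s2 s1 P m → 2 * suc m * suc m * (s2 + m * (s2 + 2 * s1 + 2 * P * 1))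
             ≡ suc m * (2 * suc m * suc m * s2) + 4 * m * suc m * (suc m * s1) + 4 * m * suc m * suc m * P
      expand = solve-∀
      collect : ∀ P n m → suc m * (P * (4 * n * m + suc m * suc m + (2 * n * m + suc m) * (2 * n * m + suc m)))
                        + 4 * m * suc m * (P * (2 * n * m + suc m)) + 4 * m * suc m * suc m * P
              ≡ suc m * P * (4 * suc n * m + suc m * suc m + (2 * suc n * m + suc m) * (2 * suc n * m + suc m))
      collect = solve-∀

    zero-moment : ∀ n → moment isZero n ≡ 1
    zero-moment zero = refl
    zero-moment (suc n) = begin
      moment isZero (suc n)                         ≡⟨ moment-step isZero n ⟩
      moment isZero n + m * ∑ (λ _ → 0) (F n)       ≡⟨ cong (λ v → moment isZero n + m * v) (∑-zero (F n)) ⟩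
      moment isZero n + m * 0                       ≡⟨ cong (moment isZero n +_) (*-zeroʳ m) ⟩
      moment isZero n + 0                           ≡⟨ +-identityʳ _ ⟩
      moment isZero n                               ≡⟨ zero-moment n ⟩
      1                                             ∎
      where open ≡-Reasoning

    twice-choose2 : ∀ k → 2 * choose2 k + k ≡ k * k
    twice-choose2 zero = refl
    twice-choose2 (suc k) = begin
      2 * (choose2 k + k) + suc k     ≡⟨ shape₁ (choose2 k) k ⟩
      (2 * choose2 k + k) + (2 * k + 1) ≡⟨ cong (_+ (2 * k + 1)) (twice-choose2 k) ⟩
      k * k + (2 * k + 1)             ≡⟨ shape₂ k ⟩
      suc k * suc k                   ∎
      where
      open ≡-Reasoning
      shape₁ : ∀ c k → 2 * (c + k) + suc k ≡ (2 * c + k) + (2 * k + 1)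
      shape₁ = solve-∀
      shape₂ : ∀ k → k * k + (2 * k + 1) ≡ suc k * suc k
      shape₂ = solve-∀

    gapPairs-quadratic : ∀ k → 2 * gapPairs k + 3 * k + 2 * isZero k ≡ k * k + 2
    gapPairs-quadratic zero = refl
    gapPairs-quadratic (suc k) = begin
      2 * choose2 k + 3 * suc k + 2 * 0     ≡⟨ shape₁ (choose2 k) k ⟩
      (2 * choose2 k + k) + (2 * k + 3)     ≡⟨ cong (_+ (2 * k + 3)) (twice-choose2 k) ⟩
      k * k + (2 * k + 3)                   ≡⟨ shape₂ k ⟩
      suc k * suc k + 2                     ∎
      where
      open ≡-Reasoning
      shape₁ : ∀ c k → 2 * c + 3 * suc k + 2 * 0 ≡ (2 * c + k) + (2 * k + 3)
      shape₁ = solve-∀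
      shape₂ : ∀ k → k * k + (2 * k + 3) ≡ suc k * suc k + 2
      shape₂ = solve-∀

    T : ℕ → ℕ
    T = moment gapPairs

    pairs-via-moments : ∀ n → 2 * T n + 3 * moment (λ k → k) n + 2 * moment isZero n ≡ moment (λ k → k * k) n + 2 * F n
    pairs-via-moments n = begin
      2 * T n + 3 * S₁ + 2 * Z
          ≡⟨ cong₂ (λ X Y → X + Y + 2 * Z) (sym (∑-*ˡ 2 (gapPairs ∘ c) (F n))) (sym (∑-*ˡ 3 c (F n))) ⟩
      ∑ (λ z → 2 * gapPairs (c z)) (F n) + ∑ (λ z → 3 * c z) (F n) + 2 * Z
          ≡⟨ cong₂ _+_ (sym (∑-+ _ _ (F n))) (sym (∑-*ˡ 2 (isZero ∘ c) (F n))) ⟩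
      ∑ (λ z → 2 * gapPairs (c z) + 3 * c z) (F n) + ∑ (λ z → 2 * isZero (c z)) (F n)
          ≡⟨ sym (∑-+ _ _ (F n)) ⟩
      ∑ (λ z → 2 * gapPairs (c z) + 3 * c z + 2 * isZero (c z)) (F n)
          ≡⟨ ∑-cong (F n) (λ z → gapPairs-quadratic (c z)) ⟩
      ∑ (λ z → c z * c z + 2) (F n)
          ≡⟨ ∑-+ _ _ (F n) ⟩
      moment (λ k → k * k) n + ∑ (λ _ → 2) (F n)
          ≡⟨ cong (moment (λ k → k * k) n +_) (trans (∑-const 2 (F n)) (*-comm (F n) 2)) ⟩
      moment (λ k → k * k) n + 2 * F n ∎
      where
      open ≡-Reasoning
      c : ℕ → ℕ
      c = summands
      S₁ : ℕ
      S₁ = moment (λ k → k) n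
      Z : ℕ
      Z = moment isZero n

    pairs-closed : ∀ n → 4 * M * M * T n + 6 * M * (M ^ n * D n) + 4 * M * M
                       ≡ M ^ n * (4 * n * m + M * M + D n * D n + 8 * M * M)
    pairs-closed n = begin
      4 * M * M * T n + 6 * M * (M ^ n * D n) + 4 * M * M
          ≡⟨ cong (λ X → 4 * M * M * T n + 6 * M * X + 4 * M * M) (sym (first-moment n)) ⟩
      4 * M * M * T n + 6 * M * (M * S₁) + 4 * M * M
          ≡⟨ shape₁ (T n) S₁ m ⟩
      2 * M * M * (2 * T n + 3 * S₁ + 2 * 1)
          ≡⟨ cong (λ X → 2 * M * M * (2 * T n + 3 * S₁ + 2 * X)) (sym (zero-moment n)) ⟩
      2 * M * M * (2 * T n + 3 * S₁ + 2 * moment isZero n)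
          ≡⟨ cong (2 * M * M *_) (pairs-via-moments n) ⟩
      2 * M * M * (S₂ + 2 * (2 * M ^ n))
          ≡⟨ shape₂ S₂ (M ^ n) m ⟩
      2 * M * M * S₂ + 8 * M * M * M ^ n
          ≡⟨ cong (_+ 8 * M * M * M ^ n) (second-moment n) ⟩
      M ^ n * (4 * n * m + M * M + D n * D n) + 8 * M * M * M ^ n
          ≡⟨ shape₃ _ (M ^ n) m ⟩
      M ^ n * (4 * n * m + M * M + D n * D n + 8 * M * M) ∎
      where
      open ≡-Reasoning
      S₁ : ℕ
      S₁ = moment (λ k → k) n
      S₂ : ℕ
      S₂ = moment (λ k → k * k) n
      shape₁ : ∀ t s1 m → 4 * suc m * suc m * t + 6 * suc m * (suc m * s1) + 4 * suc m * suc m ≡ 2 * suc m * suc m * (2 * t + 3 * s1 + 2 * 1)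
      shape₁ = solve-∀
      shape₂ : ∀ s2 P m → 2 * suc m * suc m * (s2 + 2 * (2 * P)) ≡ 2 * suc m * suc m * s2 + 8 * suc m * suc m * P
      shape₂ = solve-∀
      shape₃ : ∀ X P m → P * X + 8 * suc m * suc m * P ≡ P * (X + 8 * suc m * suc m)
      shape₃ = solve-∀

module GapCounting where

  open import Defs using (isIn; gapAt)
  open Sums
  open import Data.Nat using (ℕ; zero; suc; _+_; _*_; _∸_; _<_; _≤_; s≤s; z≤n; _≡ᵇ_; _<ᵇ_; pred)
  open import Data.Nat.Properties
  open import Data.Bool using (Bool; true; false; _∧_; _∨_; not; T)
  open import Data.Bool.ListAction using (any; all)
  open import Data.List using (List; []; _∷_; upTo; length)
  open import Data.List.Membership.Propositional using (_∈_; find; lose)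
  open import Data.List.Membership.Propositional.Properties using (∈-upTo⁺)
  open import Data.List.Relation.Unary.All as All using (All; []; _∷_)
  open import Data.List.Relation.Unary.Any as Any using (Any; here)
  open import Data.List.Relation.Unary.Any.Properties using (any⁺; any⁻)
  open import Data.List.Relation.Unary.AllPairs using (AllPairs; []; _∷_)
  open import Data.Product using (_,_; proj₁)
  open import Data.Sum using (inj₁; inj₂)
  open import Data.Bool.Properties using (T-∧)
  open import Function.Bundles using (module Equivalence)
  open import Relation.Nullary using (¬_)
  open import Data.Empty using (⊥-elim)
  open import Function using (_∘_)
  open import Relation.Binary.PropositionalEquality using (_≡_; _≢_; refl; sym; trans; cong; cong₂; subst; module ≡-Reasoning)

  T-ext : ∀ {a b : Bool} → (T a → T b) → (T b → T a) → a ≡ b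
  T-ext {true} {true} _ _ = refl
  T-ext {true} {false} to _ = ⊥-elim (to _)
  T-ext {false} {true} _ from = ⊥-elim (from _)
  T-ext {false} {false} _ _ = refl

  isIn⇒∈ : ∀ y L → T (isIn y L) → y ∈ L
  isIn⇒∈ y L t = Any.map (λ {x} e → sym (≡ᵇ⇒≡ x y e)) (any⁻ _ L t)

  ∈⇒isIn : ∀ {y L} → y ∈ L → T (isIn y L)
  ∈⇒isIn {y} p = any⁺ _ (Any.map (λ {x} e → ≡⇒≡ᵇ x y (sym e)) p)

  hasLater : ℕ → List ℕ → Bool
  hasLater j L = any (j <ᵇ_) L

  laterWithin : ℕ → ℕ → List ℕ → Bool
  laterWithin K j L = any (λ g → isIn (j + suc g) L) (upTo K)

  laterWithin-all : ∀ K j L → All (_≤ K) L → laterWithin K j L ≡ hasLater j L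
  laterWithin-all K j L L≤K = T-ext to from
    where
    to : T (laterWithin K j L) → T (hasLater j L)
    to t with find (any⁻ _ (upTo K) t)
    ... | g , _ , hit = any⁺ _ (lose (isIn⇒∈ (j + suc g) L hit) (<⇒<ᵇ j<j+1+g))
      where
      j<j+1+g : j < j + suc g
      j<j+1+g = subst (j <_) (sym (+-suc j g)) (s≤s (m≤m+n j g))
    -- A larger element x ∈ L is seen at offset x − (j + 1) < K.
    from : T (hasLater j L) → T (laterWithin K j L)
    from t with find (any⁻ _ L t)
    ... | x , x∈L , jx = any⁺ _ (lose (∈-upTo⁺ g<K) (subst (λ y → T (isIn y L)) (sym j+1+g≡x) (∈⇒isIn x∈L)))
      where
      j<x : j < x
      j<x = <ᵇ⇒< j x jx
      g : ℕ
      g = x ∸ suc j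
      j+1+g≡x : j + suc g ≡ x
      j+1+g≡x = trans (+-suc j g) (m+[n∸m]≡n j<x)
      g<K : g < K
      g<K = <-≤-trans (∸-monoʳ-< {x} {suc j} {0} (s≤s z≤n) j<x) (All.lookup L≤K x∈L)

  δ-true : ∀ {b} → T b → δ b ≡ 1
  δ-true {true} _ = refl

  δ-false : ∀ {b} → ¬ T b → δ b ≡ 0
  δ-false {true} ¬t = ⊥-elim (¬t _)
  δ-false {false} _ = refl

  gapsFrom : ℕ → ℕ → List ℕ → ℕ
  gapsFrom K j L = ∑ (λ g → δ (gapAt j (suc g) L)) K

  -- A gap starting at j exists iff j is a summand followed by a later summand;
  -- its length is the offset of the first later summand.
  gapsFrom-eq : ∀ K j L → gapsFrom K j L ≡ δ (isIn j L ∧ laterWithin K j L)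
  gapsFrom-eq K j L = begin
    ∑ (λ g → δ (isIn j L ∧ hit g)) K             ≡⟨ ∑-cong K (λ g → δ-∧ (isIn j L) (hit g)) ⟩
    ∑ (λ g → δ (isIn j L) * δ (hit g)) K         ≡⟨ ∑-*ˡ (δ (isIn j L)) (δ ∘ hit) K ⟩
    δ (isIn j L) * ∑ (δ ∘ hit) K                 ≡⟨ cong (δ (isIn j L) *_) (first-hit (λ g → isIn (j + suc g) L) K) ⟩
    δ (isIn j L) * δ (laterWithin K j L)         ≡⟨ δ-∧ (isIn j L) _ ⟨
    δ (isIn j L ∧ laterWithin K j L)             ∎
    where
    open ≡-Reasoning
    hit : ℕ → Bool
    hit g = isIn (j + suc g) L ∧ all (λ q → not (isIn (j + suc q) L)) (upTo g)

  point-miss : ∀ x N → N ≤ x → ∑ (λ j → δ (x ≡ᵇ j)) N ≡ 0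
  point-miss x zero _ = refl
  point-miss x (suc N) N<x = trans (∑-suc _ N)
    (cong₂ _+_ (point-miss x N (<⇒≤ N<x)) (δ-false (λ t → <⇒≢ N<x (sym (≡ᵇ⇒≡ x N t)))))

  point-hit : ∀ x N → x < N → ∑ (λ j → δ (x ≡ᵇ j)) N ≡ 1
  point-hit x (suc N) x<1+N with m≤n⇒m<n∨m≡n (≤-pred x<1+N)
  ... | inj₁ x<N = trans (∑-suc _ N) (trans (cong₂ _+_ (point-hit x N x<N) (δ-false (λ t → <⇒≢ x<N (≡ᵇ⇒≡ x N t)))) refl)
  ... | inj₂ refl = trans (∑-suc _ x) (cong₂ _+_ (point-miss x x ≤-refl) (δ-true (≡⇒≡ᵇ x x refl)))

  nonEmpty : List ℕ → ℕ
  nonEmpty [] = 0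
  nonEmpty (_ ∷ _) = 1

  hasLater-above : ∀ x L → All (x <_) L → δ (hasLater x L) ≡ nonEmpty L
  hasLater-above x [] [] = refl
  hasLater-above x (y ∷ L) (x<y ∷ _) = δ-true {hasLater x (y ∷ L)} (any⁺ (x <ᵇ_) (here {x = y} {xs = L} (<⇒<ᵇ x<y)))

  notIn-above : ∀ x L → All (x <_) L → ¬ T (isIn x L)
  notIn-above x L x<L t = <-irrefl refl (All.lookup x<L (isIn⇒∈ x L t))

  nonLast-head : ∀ j x L → All (x <_) L
    → δ (isIn j (x ∷ L) ∧ hasLater j (x ∷ L)) ≡ δ (x ≡ᵇ j) * nonEmpty L + δ (isIn j L ∧ hasLater j L)
  nonLast-head j x L x<L with x ≡ᵇ j in x≡ᵇj
  ... | true with ≡ᵇ⇒≡ x j (subst T (sym x≡ᵇj) _)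
  ...   | refl = begin
          δ ((x <ᵇ x) ∨ hasLater x L)        ≡⟨ cong (λ b → δ (b ∨ hasLater x L)) (<ᵇ-irrefl x) ⟩
          δ (hasLater x L)                   ≡⟨ hasLater-above x L x<L ⟩
          nonEmpty L                         ≡⟨ +-identityʳ (nonEmpty L) ⟨
          nonEmpty L + 0                     ≡⟨ cong (nonEmpty L +_) (δ-false (λ t → notIn-above x L x<L (proj₁ (Equivalence.to T-∧ t)))) ⟨
          nonEmpty L + δ (isIn x L ∧ hasLater x L) ≡⟨ cong (_+ δ (isIn x L ∧ hasLater x L)) (*-identityˡ (nonEmpty L)) ⟨
          1 * nonEmpty L + δ (isIn x L ∧ hasLater x L) ∎
    where
    open ≡-Reasoning
    <ᵇ-irrefl : ∀ x → (x <ᵇ x) ≡ false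
    <ᵇ-irrefl x = T-ext (λ t → <-irrefl refl (<ᵇ⇒< x x t)) (λ ())
  nonLast-head j x L x<L | false with isIn j L in j∈L
  ... | false = refl
  ... | true = cong (λ b → δ (b ∨ hasLater j L)) (T-ext (λ t → <-asym (<ᵇ⇒< j x t) x<j) (λ ()))
    where
    x<j : x < j
    x<j = All.lookup x<L (isIn⇒∈ j L (subst T (sym j∈L) _))

  nonLast-count : ∀ N L → AllPairs _<_ L → All (_< N) L → ∑ (λ j → δ (isIn j L ∧ hasLater j L)) N ≡ pred (length L)
  nonLast-count N [] _ _ = ∑-zero N
  nonLast-count N (x ∷ L) (x<L ∷ inc) (x<N ∷ L<N) = begin
    ∑ (λ j → δ (isIn j (x ∷ L) ∧ hasLater j (x ∷ L))) N
        ≡⟨ ∑-cong N (λ j → nonLast-head j x L x<L) ⟩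
    ∑ (λ j → δ (x ≡ᵇ j) * nonEmpty L + δ (isIn j L ∧ hasLater j L)) N
        ≡⟨ ∑-+ _ _ N ⟩
    ∑ (λ j → δ (x ≡ᵇ j) * nonEmpty L) N + ∑ (λ j → δ (isIn j L ∧ hasLater j L)) N
        ≡⟨ cong₂ _+_ (trans (∑-*ʳ (nonEmpty L) _ N) (trans (cong (_* nonEmpty L) (point-hit x N x<N)) (*-identityˡ (nonEmpty L))))
                     (nonLast-count N L inc L<N) ⟩
    nonEmpty L + pred (length L)
        ≡⟨ nonEmpty+pred L ⟩
    length L ∎
    where
    open ≡-Reasoning
    nonEmpty+pred : ∀ (L : List ℕ) → nonEmpty L + pred (length L) ≡ length L
    nonEmpty+pred [] = refl
    nonEmpty+pred (_ ∷ _) = refl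

  gap-pairs : ∀ N K L → AllPairs _<_ L → All (_< N) L → N ≤ suc K
    → ∑ (λ j₂ → ∑ (λ j₁ → gapsFrom K j₁ L * gapsFrom K j₂ L) j₂) N ≡ choose2 (pred (length L))
  gap-pairs N K L inc L<N N≤1+K = begin
    ∑ (λ j₂ → ∑ (λ j₁ → gapsFrom K j₁ L * gapsFrom K j₂ L) j₂) N
        ≡⟨ ∑-cong N (λ j₂ → ∑-cong j₂ (λ j₁ → cong₂ _*_ (gaps j₁) (gaps j₂))) ⟩
    ∑ (λ j₂ → ∑ (λ j₁ → δ (nonLast j₁) * δ (nonLast j₂)) j₂) N
        ≡⟨ ∑-pairs nonLast N ⟩
    choose2 (∑ (λ j → δ (nonLast j)) N)
        ≡⟨ cong choose2 (nonLast-count N L inc L<N) ⟩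
    choose2 (pred (length L)) ∎
    where
    open ≡-Reasoning
    nonLast : ℕ → Bool
    nonLast j = isIn j L ∧ hasLater j L
    L≤K : All (_≤ K) L
    L≤K = All.map (λ x<N → ≤-pred (≤-trans x<N N≤1+K)) L<N
    gaps : ∀ j → gapsFrom K j L ≡ δ (nonLast j)
    gaps j = trans (gapsFrom-eq K j L) (cong (λ b → δ (isIn j L ∧ b)) (laterWithin-all K j L L≤K))

module Counting where

  open import Defs using (IsMGonal; Legal; sizeI; sumX; gapAt)
  open Sums
  open MGonal using (module Explicit)
  open SummandCount using (module Digits)
  open Moments using (module SummandMoments)
  open GapCounting using (gapsFrom; gap-pairs)
  open import Data.Nat using (ℕ; suc; _+_; _*_; _<_; _≤_; s≤s; NonZero; pred)
  open import Data.Nat.Properties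
  open import Data.Nat.ListAction using (sum)
  open import Data.Bool using (_∧_)
  open import Data.List using (List; []; _∷_; map; length)
  open import Data.List.Relation.Unary.All as All using (All; []; _∷_)
  open import Data.List.Relation.Unary.AllPairs using (AllPairs)
  open import Data.Product using (_,_; proj₁; proj₂)
  open import Relation.Binary.PropositionalEquality using (_≡_; refl; sym; trans; cong; cong₂; subst; module ≡-Reasoning)

  module GapPairCount (m : ℕ) .{{_ : NonZero m}} (a : ℕ → ℕ) (isM : IsMGonal m a)
                      (dec : ℕ → List ℕ) (legal : ∀ z → Legal m a (dec z) z) where
    open Explicit m
    open Digits m
    open SummandMoments m using (T; gapPairs)

    a≡f : ∀ i → a i ≡ f i
    a≡f = mgonal-closed-form a isM

    sum-a≡sumf : ∀ (L : List ℕ) → sum (map a L) ≡ sumf L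
    sum-a≡sumf [] = refl
    sum-a≡sumf (x ∷ L) = cong₂ _+_ (a≡f x) (sum-a≡sumf L)

    sizeI≡F : ∀ n → sizeI m a n ≡ F n
    sizeI≡F n = begin
      a (m * n + 1)      ≡⟨ a≡f _ ⟩
      f (m * n + 1)      ≡⟨ cong f (+-comm (m * n) 1) ⟩
      f (suc (m * n))    ≡⟨ f-bin-start n ⟩
      F n                ∎
      where open ≡-Reasoning

    dec-sum : ∀ z → sumf (dec z) ≡ z
    dec-sum z = trans (sym (sum-a≡sumf (dec z))) (proj₂ (proj₂ (legal z)))

    dec-increasing : ∀ z → AllPairs _<_ (dec z)
    dec-increasing z = proj₁ (legal z)

    dec-length : ∀ z → length (dec z) ≡ summands z
    dec-length z = trans (length-legal (dec z) (dec-increasing z) (proj₁ (proj₂ (legal z)))) (cong summands (dec-sum z))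

    term≤sum : ∀ (L : List ℕ) → All (λ y → f y ≤ sumf L) L
    term≤sum [] = []
    term≤sum (x ∷ L) = m≤m+n (f x) (sumf L) ∷ All.map (λ p → ≤-trans p (m≤n+m (sumf L) (f x))) (term≤sum L)

    dec-bound : ∀ n z → z < F n → All (_< suc (m * n)) (dec z)
    dec-bound n z z<F = All.map small (term≤sum (dec z))
      where
      small : ∀ {y} → f y ≤ sumf (dec z) → y < suc (m * n)
      small {y} fy≤z = ≰⇒> (λ big → <-irrefl refl (<-≤-trans (≤-<-trans fy≤z (subst (_< F n) (sym (dec-sum z)) z<F))
                                                         (subst (_≤ f y) (f-bin-start n) (f-mono big))))

    totalPairs : ℕ → ℕ → ℕ
    totalPairs n K = ∑ (λ g₁ → ∑ (λ g₂ → sumX m a dec n (suc g₁) (suc g₂)) K) K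

    gap : ℕ → ℕ → ℕ → ℕ
    gap z j g = δ (gapAt j (suc g) (dec z))

    pairs-per-z : ∀ N K z →
      ∑ (λ g₁ → ∑ (λ g₂ → ∑ (λ j₂ → ∑ (λ j₁ → gap z j₁ g₁ * gap z j₂ g₂) j₂) N) K) K
      ≡ ∑ (λ j₂ → ∑ (λ j₁ → gapsFrom K j₁ (dec z) * gapsFrom K j₂ (dec z)) j₂) N
    pairs-per-z N K z = begin
      ∑ (λ g₁ → ∑ (λ g₂ → ∑ (λ j₂ → ∑ (λ j₁ → gap z j₁ g₁ * gap z j₂ g₂) j₂) N) K) K
          ≡⟨ ∑-cong K (λ g₁ → ∑-swap-triangle (λ j₁ j₂ g₂ → gap z j₁ g₁ * gap z j₂ g₂) K N) ⟩
      ∑ (λ g₁ → ∑ (λ j₂ → ∑ (λ j₁ → ∑ (λ g₂ → gap z j₁ g₁ * gap z j₂ g₂) K) j₂) N) K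
          ≡⟨ ∑-swap-triangle (λ j₁ j₂ g₁ → ∑ (λ g₂ → gap z j₁ g₁ * gap z j₂ g₂) K) K N ⟩
      ∑ (λ j₂ → ∑ (λ j₁ → ∑ (λ g₁ → ∑ (λ g₂ → gap z j₁ g₁ * gap z j₂ g₂) K) K) j₂) N
          ≡⟨ ∑-cong N (λ j₂ → ∑-cong j₂ (λ j₁ → ∑-product (gap z j₁) (gap z j₂) K K)) ⟩
      ∑ (λ j₂ → ∑ (λ j₁ → gapsFrom K j₁ (dec z) * gapsFrom K j₂ (dec z)) j₂) N ∎
      where open ≡-Reasoning

    -- Once K ≥ m·n every gap inside I_n is counted, and the total is the
    -- number T n of pairs of gaps, summed over I_n.
    totalPairs≡T : ∀ n K → m * n ≤ K → totalPairs n K ≡ T n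
    totalPairs≡T n K mn≤K = begin
      ∑ (λ g₁ → ∑ (λ g₂ → ∑ (λ j₂ → ∑ (λ j₁ → ∑ (λ z → both z j₁ g₁ j₂ g₂) Z) j₂) N) K) K
          ≡⟨ ∑-cong K (λ g₁ → ∑-cong K (λ g₂ → ∑-cong N (λ j₂ → ∑-cong j₂ (λ j₁ →
               ∑-cong Z (λ z → δ-∧ (gapAt j₁ (suc g₁) (dec z)) _))))) ⟩
      ∑ (λ g₁ → ∑ (λ g₂ → ∑ (λ j₂ → ∑ (λ j₁ → ∑ (λ z → gap z j₁ g₁ * gap z j₂ g₂) Z) j₂) N) K) K
          ≡⟨ ∑-cong K (λ g₁ → ∑-cong K (λ g₂ → sym (∑-swap-triangle (λ j₁ j₂ z → gap z j₁ g₁ * gap z j₂ g₂) Z N))) ⟩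
      ∑ (λ g₁ → ∑ (λ g₂ → ∑ (Φ g₁ g₂) Z) K) K
          ≡⟨ ∑-cong K (λ g₁ → ∑-swap (λ g₂ z → Φ g₁ g₂ z) K Z) ⟩
      ∑ (λ g₁ → ∑ (λ z → ∑ (λ g₂ → Φ g₁ g₂ z) K) Z) K
          ≡⟨ ∑-swap (λ g₁ z → ∑ (λ g₂ → Φ g₁ g₂ z) K) K Z ⟩
      ∑ (λ z → ∑ (λ g₁ → ∑ (λ g₂ → Φ g₁ g₂ z) K) K) Z
          ≡⟨ cong (λ size → ∑ (λ z → ∑ (λ g₁ → ∑ (λ g₂ → Φ g₁ g₂ z) K) K) size) (sizeI≡F n) ⟩
      ∑ (λ z → ∑ (λ g₁ → ∑ (λ g₂ → Φ g₁ g₂ z) K) K) (F n)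
          ≡⟨ ∑-cong< (F n) (λ z z<F → trans (pairs-per-z N K z)
               (gap-pairs N K (dec z) (dec-increasing z) (dec-bound n z z<F) (s≤s mn≤K))) ⟩
      ∑ (λ z → choose2 (pred (length (dec z)))) (F n)
          ≡⟨ ∑-cong (F n) (λ z → cong gapPairs (dec-length z)) ⟩
      T n ∎
      where
      open ≡-Reasoning
      N : ℕ
      N = suc (m * n)
      Z : ℕ
      Z = sizeI m a n
      both : ℕ → ℕ → ℕ → ℕ → ℕ → ℕ
      both z j₁ g₁ j₂ g₂ = δ (gapAt j₁ (suc g₁) (dec z) ∧ gapAt j₂ (suc g₂) (dec z))
      Φ : ℕ → ℕ → ℕ → ℕ
      Φ g₁ g₂ z = ∑ (λ j₂ → ∑ (λ j₁ → gap z j₁ g₁ * gap z j₂ g₂) j₂) N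

module Fractions where

  open import Defs using (ℕtoℚ; inv)
  open import Data.Nat as Nat using (ℕ; zero; suc)
  open import Data.Integer as ℤ using (+_)
  import Data.Integer.Properties as ℤP
  open import Data.Rational using (ℚ; 0ℚ; 1ℚ; mkℚ; _+_; _*_; _-_; _≤_; _<_; 1/_; ↥_; ≢-nonZero; *≤*; *<*; nonNegative; positive)
  open import Data.Rational.Properties
  open import Data.Nat.Coprimality using (Coprime)
  open import Data.Nat.Divisibility using (∣1⇒≡1)
  open import Data.Product using (_,_)
  open import Data.Empty using (⊥-elim)
  open import Relation.Nullary using (yes; no)
  open import Relation.Binary.PropositionalEquality using (_≡_; _≢_; refl; sym; trans; cong; cong₂; subst; subst₂; module ≡-Reasoning)
  open import Data.Rational.Solver using (module +-*-Solver)
  open +-*-Solver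

  -- The embedding ℕ → ℚ, kept abstract so that rational normalisation never
  -- unfolds it on concrete or symbolic arguments; all we use are the facts below.
  abstract
    ι : ℕ → ℚ
    ι = ℕtoℚ

    ι≡ℕtoℚ : ∀ k → ι k ≡ ℕtoℚ k
    ι≡ℕtoℚ k = refl

    coprime-1 : ∀ k → Coprime k 1
    coprime-1 k (_ , d∣1) = ∣1⇒≡1 d∣1

    ι-normal : ∀ k → ι k ≡ mkℚ (+ k) 0 (coprime-1 k)
    ι-normal k = normalize-coprime (coprime-1 k)

    ι-+ : ∀ a b → ι (a Nat.+ b) ≡ ι a + ι b
    ι-+ a b rewrite ι-normal a | ι-normal b = trans (ι-normal (a Nat.+ b)) (sym (trans (/-cong e refl) (ι-normal (a Nat.+ b))))
      where
      e : + a ℤ.* + 1 ℤ.+ + b ℤ.* + 1 ≡ + (a Nat.+ b)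
      e = trans (cong₂ ℤ._+_ (ℤP.*-identityʳ (+ a)) (ℤP.*-identityʳ (+ b))) (sym (ℤP.pos-+ a b))

    ι-* : ∀ a b → ι (a Nat.* b) ≡ ι a * ι b
    ι-* a b rewrite ι-normal a | ι-normal b = trans (ι-normal (a Nat.* b)) (sym (trans (/-cong (sym (ℤP.pos-* a b)) refl) (ι-normal (a Nat.* b))))

    ι-0 : ι 0 ≡ 0ℚ
    ι-0 = refl

    ι-1 : ι 1 ≡ 1ℚ
    ι-1 = refl

    ι-suc≢0 : ∀ k → ι (suc k) ≢ 0ℚ
    ι-suc≢0 k e with trans (sym (cong ↥_ (ι-normal (suc k)))) (cong ↥_ e)
    ... | ()

  ι-≢0 : ∀ {k} → k ≢ 0 → ι k ≢ 0ℚ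
  ι-≢0 {zero} k≢0 = ⊥-elim (k≢0 refl)
  ι-≢0 {suc k} _ = ι-suc≢0 k

  inv-nonzero : ∀ p (p≢0 : p ≢ 0ℚ) → inv p ≡ (1/ p) {{≢-nonZero p≢0}}
  inv-nonzero p p≢0 with p ≟ 0ℚ
  ... | yes p≡0 = ⊥-elim (p≢0 p≡0)
  ... | no _ = refl

  inv-cancel : ∀ p → p ≢ 0ℚ → inv p * p ≡ 1ℚ
  inv-cancel p p≢0 = trans (cong (_* p) (inv-nonzero p p≢0)) (*-inverseˡ p {{≢-nonZero p≢0}})

  ι-mono : ∀ {a b} → a Nat.≤ b → ι a ≤ ι b
  ι-mono {a} {b} p rewrite ι-normal a | ι-normal b =
    *≤* (subst₂ ℤ._≤_ (sym (ℤP.*-identityʳ (+ a))) (sym (ℤP.*-identityʳ (+ b))) (ℤ.+≤+ p))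

  ι-mono-< : ∀ {a b} → a Nat.< b → ι a < ι b
  ι-mono-< {a} {b} p rewrite ι-normal a | ι-normal b =
    *<* (subst₂ ℤ._<_ (sym (ℤP.*-identityʳ (+ a))) (sym (ℤP.*-identityʳ (+ b))) (ℤ.+<+ p))

  ι-nonneg : ∀ k → 0ℚ ≤ ι k
  ι-nonneg k = subst (_≤ ι k) ι-0 (ι-mono {0} {k} Nat.z≤n)

  inv-ι-normal : ∀ k → inv (ι (suc k)) ≡ mkℚ (+ 1) k (λ (x , y) → coprime-1 (suc k) (y , x))
  inv-ι-normal k = trans (cong inv (ι-normal (suc k))) (inv-nonzero _ (λ e → ι-suc≢0 k (trans (ι-normal (suc k)) e)))

  inv-ι-pos : ∀ k → 0ℚ < inv (ι (suc k))
  inv-ι-pos k = subst (0ℚ <_) (sym (inv-ι-normal k)) (*<* (ℤ.+<+ (Nat.s≤s Nat.z≤n)))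

  inv-ι-nonneg : ∀ k → 0ℚ ≤ inv (ι k)
  inv-ι-nonneg zero = subst (λ p → 0ℚ ≤ inv p) (sym ι-0) ≤-refl
  inv-ι-nonneg (suc k) = <⇒≤ (inv-ι-pos k)

  nonneg-* : ∀ {p q} → 0ℚ ≤ p → 0ℚ ≤ q → 0ℚ ≤ p * q
  nonneg-* {p} {q} p≥0 q≥0 = nonNegative⁻¹ (p * q) {{nonNeg*nonNeg⇒nonNeg p {{nonNegative p≥0}} q {{nonNegative q≥0}}}}

  pos-* : ∀ {p q} → 0ℚ < p → 0ℚ < q → 0ℚ < p * q
  pos-* {p} {q} p>0 q>0 = positive⁻¹ (p * q) {{pos*pos⇒pos p {{positive p>0}} q {{positive q>0}}}}

  *-monoʳ-nonneg : ∀ {r p q} → 0ℚ ≤ r → p ≤ q → p * r ≤ q * r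
  *-monoʳ-nonneg {r} r≥0 = *-monoʳ-≤-nonNeg r {{nonNegative r≥0}}

  -- The fraction a / b of natural numbers as a rational (0 when b = 0).
  infix 8 _÷_
  _÷_ : ℕ → ℕ → ℚ
  a ÷ b = ι a * inv (ι b)

  ÷-nonneg : ∀ a b → 0ℚ ≤ a ÷ b
  ÷-nonneg a b = nonneg-* (ι-nonneg a) (inv-ι-nonneg b)

  ÷-+ : ∀ a c b → a ÷ b + c ÷ b ≡ (a Nat.+ c) ÷ b
  ÷-+ a c b = trans (sym (*-distribʳ-+ (inv (ι b)) (ι a) (ι c))) (cong (_* inv (ι b)) (sym (ι-+ a c)))

  ι-*-÷ : ∀ x a b → ι x * (a ÷ b) ≡ (x Nat.* a) ÷ b
  ι-*-÷ x a b = trans (sym (*-assoc (ι x) (ι a) (inv (ι b)))) (cong (_* inv (ι b)) (sym (ι-* x a)))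

  ÷-expand : ∀ a b d → d ≢ 0 → a ÷ b ≡ ι (a Nat.* d) * (inv (ι b) * inv (ι d))
  ÷-expand a b d d≢0 = begin
    ι a * inv (ι b)                                ≡⟨ *-identityʳ _ ⟨
    ι a * inv (ι b) * 1ℚ                           ≡⟨ cong (ι a * inv (ι b) *_) (inv-cancel (ι d) (ι-≢0 d≢0)) ⟨
    ι a * inv (ι b) * (inv (ι d) * ι d)            ≡⟨ regroup (ι a) (inv (ι b)) (ι d) (inv (ι d)) ⟩
    (ι a * ι d) * (inv (ι b) * inv (ι d))          ≡⟨ cong (_* _) (ι-* a d) ⟨
    ι (a Nat.* d) * (inv (ι b) * inv (ι d))          ∎
    where
    open ≡-Reasoning
    regroup : ∀ x ib d id → x * ib * (id * d) ≡ (x * d) * (ib * id)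
    regroup = solve 4 (λ x ib d id → x :* ib :* (id :* d) := (x :* d) :* (ib :* id)) refl

  ÷-cross : ∀ a b c d → b ≢ 0 → d ≢ 0 → a Nat.* d ≡ c Nat.* b → a ÷ b ≡ c ÷ d
  ÷-cross a b c d b≢0 d≢0 ad≡cb = begin
    a ÷ b                                          ≡⟨ ÷-expand a b d d≢0 ⟩
    ι (a Nat.* d) * (inv (ι b) * inv (ι d))          ≡⟨ cong (λ v → ι v * (inv (ι b) * inv (ι d))) ad≡cb ⟩
    ι (c Nat.* b) * (inv (ι b) * inv (ι d))          ≡⟨ cong (ι (c Nat.* b) *_) (*-comm (inv (ι b)) _) ⟩
    ι (c Nat.* b) * (inv (ι d) * inv (ι b))          ≡⟨ ÷-expand c d b b≢0 ⟨
    c ÷ d                                          ∎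
    where open ≡-Reasoning

  ÷-≤ : ∀ a b c d → b ≢ 0 → d ≢ 0 → a Nat.* d Nat.≤ c Nat.* b → a ÷ b ≤ c ÷ d
  ÷-≤ a b c d b≢0 d≢0 ad≤cb = begin
    a ÷ b                                          ≡⟨ ÷-expand a b d d≢0 ⟩
    ι (a Nat.* d) * (inv (ι b) * inv (ι d))          ≤⟨ *-monoʳ-nonneg (nonneg-* (inv-ι-nonneg b) (inv-ι-nonneg d)) (ι-mono ad≤cb) ⟩
    ι (c Nat.* b) * (inv (ι b) * inv (ι d))          ≡⟨ cong (ι (c Nat.* b) *_) (*-comm (inv (ι b)) _) ⟩
    ι (c Nat.* b) * (inv (ι d) * inv (ι b))          ≡⟨ ÷-expand c d b b≢0 ⟨
    c ÷ d                                          ∎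
    where open ≤-Reasoning

  ÷-< : ∀ a b c d → a Nat.* suc d Nat.< c Nat.* suc b → a ÷ suc b < c ÷ suc d
  ÷-< a b c d ad<cb = begin-strict
    a ÷ suc b                                      ≡⟨ ÷-expand a (suc b) (suc d) (λ ()) ⟩
    ι (a Nat.* suc d) * r                            <⟨ *-monoˡ-<-pos r {{positive r>0}} (ι-mono-< ad<cb) ⟩
    ι (c Nat.* suc b) * r                            ≡⟨ cong (ι (c Nat.* suc b) *_) (*-comm (inv (ι (suc b))) _) ⟩
    ι (c Nat.* suc b) * (inv (ι (suc d)) * inv (ι (suc b))) ≡⟨ ÷-expand c (suc d) (suc b) (λ ()) ⟨
    c ÷ suc d                                      ∎
    where
    open ≤-Reasoning
    r : ℚ
    r = inv (ι (suc b)) * inv (ι (suc d))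
    r>0 : 0ℚ < r
    r>0 = pos-* (inv-ι-pos b) (inv-ι-pos d)

  1-÷ : ∀ a b c → b ≢ 0 → a Nat.+ c ≡ b → 1ℚ - a ÷ b ≡ c ÷ b
  1-÷ a b c b≢0 a+c≡b = begin
    1ℚ - ι a * ib                      ≡⟨ cong (_- ι a * ib) (trans (*-comm (ι b) ib) (inv-cancel (ι b) (ι-≢0 b≢0))) ⟨
    ι b * ib - ι a * ib                ≡⟨ cong (λ v → ι v * ib - ι a * ib) a+c≡b ⟨
    ι (a Nat.+ c) * ib - ι a * ib        ≡⟨ cong (λ v → v * ib - ι a * ib) (ι-+ a c) ⟩
    (ι a + ι c) * ib - ι a * ib        ≡⟨ solve 3 (λ x y z → (x :+ y) :* z :- x :* z := y :* z) refl (ι a) (ι c) ib ⟩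
    ι c * ib                           ∎
    where
    open ≡-Reasoning
    ib : ℚ
    ib = inv (ι b)

  ÷-intro : ∀ X B c → B ≢ 0 → X * ι B ≡ ι c → X ≡ c ÷ B
  ÷-intro X B c B≢0 XB≡c = begin
    X                          ≡⟨ *-identityʳ X ⟨
    X * 1ℚ                     ≡⟨ cong (X *_) (trans (*-comm (ι B) (inv (ι B))) (inv-cancel (ι B) (ι-≢0 B≢0))) ⟨
    X * (ι B * inv (ι B))      ≡⟨ *-assoc X (ι B) (inv (ι B)) ⟨
    X * ι B * inv (ι B)        ≡⟨ cong (_* inv (ι B)) XB≡c ⟩
    c ÷ B                      ∎
    where open ≡-Reasoning

module RationalSums where

  open Sums using (module RangeSums) renaming (∑ to ∑ℕ; ∑-suc to ∑ℕ-suc)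
  open Fractions using (ι; ι-0; ι-+)
  open import Algebra.Structures using (module IsCommutativeRing)
  open import Data.Nat as Nat using (ℕ; zero; suc)
  import Data.Nat.Properties as ℕₚ
  open import Data.Rational using (ℚ; 0ℚ; _+_; _-_; -_; _≤_)
  open import Data.Rational.Properties
  open import Relation.Binary.PropositionalEquality using (_≡_; refl; sym; cong; cong₂; module ≡-Reasoning)
  open import Data.Rational.Solver using (module +-*-Solver)
  open +-*-Solver

  -- Finite sums of rationals; ∑ℚ h N = sumℚ (map h (upTo N)) by computation.
  open RangeSums (IsCommutativeRing.isCommutativeSemiring +-*-isCommutativeRing) public
    using ()
    renaming ( ∑ to ∑ℚ; ∑-suc to ∑ℚ-suc; ∑-shift to ∑ℚ-shift; ∑-cong< to ∑ℚ-cong<; ∑-cong to ∑ℚ-cong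
             ; ∑-*ˡ to ∑ℚ-*ˡ; ∑-*ʳ to ∑ℚ-*ʳ; ∑-blocks to ∑ℚ-blocks)

  ∑ℚ-- : ∀ h h' N → ∑ℚ (λ i → h i - h' i) N ≡ ∑ℚ h N - ∑ℚ h' N
  ∑ℚ-- h h' zero = refl
  ∑ℚ-- h h' (suc N) = begin
    ∑ℚ (λ i → h i - h' i) (suc N)                 ≡⟨ ∑ℚ-suc _ N ⟩
    ∑ℚ (λ i → h i - h' i) N + (h N - h' N)        ≡⟨ cong (_+ (h N - h' N)) (∑ℚ-- h h' N) ⟩
    (∑ℚ h N - ∑ℚ h' N) + (h N - h' N)             ≡⟨ regroup (∑ℚ h N) (∑ℚ h' N) (h N) (h' N) ⟩
    (∑ℚ h N + h N) - (∑ℚ h' N + h' N)             ≡⟨ sym (cong₂ _-_ (∑ℚ-suc h N) (∑ℚ-suc h' N)) ⟩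
    ∑ℚ h (suc N) - ∑ℚ h' (suc N)                  ∎
    where
    open ≡-Reasoning
    regroup : ∀ s t a b → (s - t) + (a - b) ≡ (s + a) - (t + b)
    regroup = solve 4 (λ s t a b → (s :- t) :+ (a :- b) := (s :+ a) :- (t :+ b)) refl

  ∑ℚ-ι : ∀ h N → ∑ℚ (λ i → ι (h i)) N ≡ ι (∑ℕ h N)
  ∑ℚ-ι h zero = sym ι-0
  ∑ℚ-ι h (suc N) = begin
    ∑ℚ (λ i → ι (h i)) (suc N)       ≡⟨ ∑ℚ-suc _ N ⟩
    ∑ℚ (λ i → ι (h i)) N + ι (h N)   ≡⟨ cong (_+ ι (h N)) (∑ℚ-ι h N) ⟩
    ι (∑ℕ h N) + ι (h N)             ≡⟨ ι-+ (∑ℕ h N) (h N) ⟨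
    ι (∑ℕ h N Nat.+ h N)             ≡⟨ cong ι (∑ℕ-suc h N) ⟨
    ι (∑ℕ h (suc N))                 ∎
    where open ≡-Reasoning

  ∑ℚ-mono : ∀ h → (∀ i → 0ℚ ≤ h i) → ∀ K d → ∑ℚ h K ≤ ∑ℚ h (K Nat.+ d)
  ∑ℚ-mono h h≥0 K zero = ≤-reflexive (cong (∑ℚ h) (sym (ℕₚ.+-identityʳ K)))
  ∑ℚ-mono h h≥0 K (suc d) = begin
    ∑ℚ h K                          ≤⟨ ∑ℚ-mono h h≥0 K d ⟩
    ∑ℚ h (K Nat.+ d)                ≡⟨ +-identityʳ _ ⟨
    ∑ℚ h (K Nat.+ d) + 0ℚ           ≤⟨ +-monoʳ-≤ (∑ℚ h (K Nat.+ d)) (h≥0 (K Nat.+ d)) ⟩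
    ∑ℚ h (K Nat.+ d) + h (K Nat.+ d) ≡⟨ ∑ℚ-suc h (K Nat.+ d) ⟨
    ∑ℚ h (suc (K Nat.+ d))          ≡⟨ cong (∑ℚ h) (ℕₚ.+-suc K d) ⟨
    ∑ℚ h (K Nat.+ suc d)            ∎
    where open ≤-Reasoning

module GapDistribution where

  open import Defs using (P; ℕtoℚ; inv)
  open Sums using (∑; ∑-suc)
  open MGonal using (quotient-of; remainder-of; module Explicit)
  open Fractions
  open RationalSums
  open import Data.Nat as Nat using (ℕ; zero; suc; _∸_; _^_; NonZero)
  import Data.Nat.Properties as ℕₚ
  open import Data.Nat.DivMod using (_/_; _%_)
  open import Data.Nat.Tactic.RingSolver using (solve-∀)
  open import Data.Rational using (ℚ; 0ℚ; 1ℚ; _+_; _*_; _-_; _≤_; nonNegative)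
  open import Data.Rational.Properties
  open import Relation.Binary.PropositionalEquality using (_≡_; _≢_; refl; sym; trans; cong; cong₂; subst; subst₂; module ≡-Reasoning)
  open import Data.Rational.Solver using (module +-*-Solver)
  open +-*-Solver

  gauss : ∀ k → 2 Nat.* ∑ (λ β → β) k Nat.+ k ≡ k Nat.* k
  gauss zero = refl
  gauss (suc k) = begin
    2 Nat.* ∑ (λ β → β) (suc k) Nat.+ suc k                     ≡⟨ cong (λ v → 2 Nat.* v Nat.+ suc k) (∑-suc (λ β → β) k) ⟩
    2 Nat.* (∑ (λ β → β) k Nat.+ k) Nat.+ suc k                 ≡⟨ shape₁ (∑ (λ β → β) k) k ⟩
    (2 Nat.* ∑ (λ β → β) k Nat.+ k) Nat.+ (2 Nat.* k Nat.+ 1)   ≡⟨ cong (Nat._+ (2 Nat.* k Nat.+ 1)) (gauss k) ⟩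
    k Nat.* k Nat.+ (2 Nat.* k Nat.+ 1)                         ≡⟨ shape₂ k ⟩
    suc k Nat.* suc k                                           ∎
    where
    open ≡-Reasoning
    shape₁ : ∀ s k → 2 Nat.* (s Nat.+ k) Nat.+ suc k ≡ (2 Nat.* s Nat.+ k) Nat.+ (2 Nat.* k Nat.+ 1)
    shape₁ = solve-∀
    shape₂ : ∀ k → k Nat.* k Nat.+ (2 Nat.* k Nat.+ 1) ≡ suc k Nat.* suc k
    shape₂ = solve-∀

  gauss-rev : ∀ k c → k Nat.≤ c → 2 Nat.* ∑ (λ β → c ∸ β) k Nat.+ k Nat.* k ≡ k Nat.* (2 Nat.* c Nat.+ 1)
  gauss-rev zero c _ = refl
  gauss-rev (suc k) c k<c = begin
    2 Nat.* ∑ (λ β → c ∸ β) (suc k) Nat.+ suc k Nat.* suc k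
        ≡⟨ cong (λ v → 2 Nat.* v Nat.+ suc k Nat.* suc k) (∑-suc (λ β → c ∸ β) k) ⟩
    2 Nat.* (∑ (λ β → c ∸ β) k Nat.+ (c ∸ k)) Nat.+ suc k Nat.* suc k
        ≡⟨ shape₁ (∑ (λ β → c ∸ β) k) (c ∸ k) k ⟩
    (2 Nat.* ∑ (λ β → c ∸ β) k Nat.+ k Nat.* k) Nat.+ 2 Nat.* ((c ∸ k) Nat.+ k) Nat.+ 1
        ≡⟨ cong₂ (λ u v → u Nat.+ 2 Nat.* v Nat.+ 1) (gauss-rev k c k≤c) (ℕₚ.m∸n+n≡m k≤c) ⟩
    k Nat.* (2 Nat.* c Nat.+ 1) Nat.+ 2 Nat.* c Nat.+ 1
        ≡⟨ shape₂ k c ⟩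
    suc k Nat.* (2 Nat.* c Nat.+ 1) ∎
    where
    open ≡-Reasoning
    k≤c : k Nat.≤ c
    k≤c = ℕₚ.<⇒≤ k<c
    shape₁ : ∀ s d k → 2 Nat.* (s Nat.+ d) Nat.+ suc k Nat.* suc k ≡ (2 Nat.* s Nat.+ k Nat.* k) Nat.+ 2 Nat.* (d Nat.+ k) Nat.+ 1
    shape₁ = solve-∀
    shape₂ : ∀ k c → k Nat.* (2 Nat.* c Nat.+ 1) Nat.+ 2 Nat.* c Nat.+ 1 ≡ suc k Nat.* (2 Nat.* c Nat.+ 1)
    shape₂ = solve-∀

  ∑ℚ-÷ : ∀ h b N → ∑ℚ (λ i → h i ÷ b) N ≡ ∑ h N ÷ b
  ∑ℚ-÷ h b N = trans (∑ℚ-*ʳ (inv (ι b)) (λ i → ι (h i)) N) (cong (_* inv (ι b)) (∑ℚ-ι h N))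

  pos⇒≢0 : ∀ {x} → 0 Nat.< x → x ≢ 0
  pos⇒≢0 {suc x} _ ()

  module LimitingDistribution (m : ℕ) .{{_ : NonZero m}} where
    open Explicit m using (M; 0<m)

    P-digits : ℕ → ℕ → ℚ
    P-digits zero β = β ÷ (m Nat.* M)
    P-digits (suc α) β = (M ∸ β) ÷ (M ^ suc (suc α))

    P-by-digits : ∀ g → P m g ≡ P-digits (g / m) (g % m)
    P-by-digits g with g / m
    ... | zero = sym (cong₂ (λ x y → x * inv y) (ι≡ℕtoℚ (g % m)) (ι≡ℕtoℚ (m Nat.* M)))
    ... | suc α = sym (cong₂ (λ x y → x * inv y) (ι≡ℕtoℚ (M ∸ g % m)) (ι≡ℕtoℚ (M ^ suc (suc α))))

    P-at : ∀ α β → β Nat.< m → P m (β Nat.+ α Nat.* m) ≡ P-digits α β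
    P-at α β β<m = trans (P-by-digits _) (cong₂ P-digits (quotient-of m β α β<m) (remainder-of m β α β<m))

    P-nonneg : ∀ g → 0ℚ ≤ P m g
    P-nonneg g = subst (0ℚ ≤_) (sym (P-by-digits g)) (digits-nonneg (g / m) (g % m))
      where
      digits-nonneg : ∀ α β → 0ℚ ≤ P-digits α β
      digits-nonneg zero β = ÷-nonneg β _
      digits-nonneg (suc α) β = ÷-nonneg (M ∸ β) _

    P-0 : P m 0 ≡ 0ℚ
    P-0 = trans (P-at 0 0 0<m) (trans (cong (_* inv (ι (m Nat.* M))) ι-0) (*-zeroˡ (inv (ι (m Nat.* M)))))

    ΣP : ℕ → ℚ
    ΣP K = ∑ℚ (λ g → P m (suc g)) K

    ΣP-from-0 : ∀ K → ∑ℚ (P m) (suc K) ≡ ΣP K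
    ΣP-from-0 K = trans (∑ℚ-shift (P m) K) (trans (cong (_+ ΣP K) P-0) (+-identityˡ (ΣP K)))

    ΣP-mono : ∀ K d → ΣP K ≤ ΣP (K Nat.+ d)
    ΣP-mono = ∑ℚ-mono (λ g → P m (suc g)) (λ g → P-nonneg (suc g))

    block : ℕ → ℚ
    block α = ∑ℚ (λ β → P m (α Nat.* m Nat.+ β)) m

    block-digits : ∀ α → block α ≡ ∑ℚ (P-digits α) m
    block-digits α = ∑ℚ-cong< m (λ β β<m → trans (cong (P m) (ℕₚ.+-comm (α Nat.* m) β)) (P-at α β β<m))

    -- The tail mass beyond the first α bins: (m + 3) / (2 (m+1)^α).
    tail : ℕ → ℚ
    tail α = (m Nat.+ 3) ÷ (2 Nat.* M ^ α)

    M^-pos : ∀ α → 0 Nat.< M ^ α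
    M^-pos α = ℕₚ.m^n>0 M α

    2M^-pos : ∀ α → 0 Nat.< 2 Nat.* M ^ α
    2M^-pos α = ℕₚ.≤-trans (M^-pos α) (ℕₚ.m≤m+n (M ^ α) _)

    first-block-num : ∀ k s → 0 Nat.< k → 2 Nat.* s Nat.+ k ≡ k Nat.* k
      → s Nat.* (2 Nat.* (suc k Nat.* 1)) ≡ (k ∸ 1) Nat.* (k Nat.* suc k)
    first-block-num (suc k) s _ e = begin
      s Nat.* (2 Nat.* (suc (suc k) Nat.* 1))         ≡⟨ shape₁ s k ⟩
      2 Nat.* s Nat.* suc (suc k)                     ≡⟨ cong (Nat._* suc (suc k)) twice-s ⟩
      k Nat.* suc k Nat.* suc (suc k)                 ≡⟨ ℕₚ.*-assoc k (suc k) _ ⟩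
      k Nat.* (suc k Nat.* suc (suc k))               ∎
      where
      open ≡-Reasoning
      shape₁ : ∀ s k → s Nat.* (2 Nat.* (suc (suc k) Nat.* 1)) ≡ 2 Nat.* s Nat.* suc (suc k)
      shape₁ = solve-∀
      shape₂ : ∀ k → suc k Nat.* suc k ≡ k Nat.* suc k Nat.+ suc k
      shape₂ = solve-∀
      twice-s : 2 Nat.* s ≡ k Nat.* suc k
      twice-s = ℕₚ.+-cancelʳ-≡ (suc k) _ _ (trans e (shape₂ k))

    later-block-num : 2 Nat.* ∑ (λ β → M ∸ β) m ≡ m Nat.* (m Nat.+ 3)
    later-block-num = ℕₚ.+-cancelʳ-≡ (m Nat.* m) _ _ (trans (gauss-rev m M (ℕₚ.n≤1+n m)) (shape m))
      where
      shape : ∀ m → m Nat.* (2 Nat.* suc m Nat.+ 1) ≡ m Nat.* (m Nat.+ 3) Nat.+ m Nat.* m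
      shape = solve-∀

    blocks-sum : ∀ α → ∑ℚ block (suc α) ≡ 1ℚ - tail (suc α)
    blocks-sum zero = begin
      ∑ℚ block 1                                     ≡⟨ trans (∑ℚ-suc block 0) (+-identityˡ (block 0)) ⟩
      block 0                                        ≡⟨ trans (block-digits 0) (∑ℚ-÷ (λ β → β) (m Nat.* M) m) ⟩
      ∑ (λ β → β) m ÷ (m Nat.* M)                    ≡⟨ ÷-cross _ _ (m ∸ 1) (2 Nat.* M ^ 1) (pos⇒≢0 mM-pos) (pos⇒≢0 (2M^-pos 1))
                                                          (first-block-num m (∑ (λ β → β) m) 0<m (gauss m)) ⟩
      (m ∸ 1) ÷ (2 Nat.* M ^ 1)                      ≡⟨ 1-÷ (m Nat.+ 3) (2 Nat.* M ^ 1) (m ∸ 1) (pos⇒≢0 (2M^-pos 1)) (numerators m 0<m) ⟨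
      1ℚ - tail 1                                    ∎
      where
      open ≡-Reasoning
      mM-pos : 0 Nat.< m Nat.* M
      mM-pos = ℕₚ.≤-trans 0<m (ℕₚ.m≤m*n m M)
      numerators : ∀ k → 0 Nat.< k → k Nat.+ 3 Nat.+ (k ∸ 1) ≡ 2 Nat.* (suc k Nat.* 1)
      numerators (suc k) _ = shape k
        where
        shape : ∀ k → suc k Nat.+ 3 Nat.+ k ≡ 2 Nat.* (suc (suc k) Nat.* 1)
        shape = solve-∀
    blocks-sum (suc α) = begin
      ∑ℚ block (suc (suc α))                          ≡⟨ ∑ℚ-suc block (suc α) ⟩
      ∑ℚ block (suc α) + block (suc α)                ≡⟨ cong₂ _+_ (blocks-sum α) (trans (block-digits (suc α)) (∑ℚ-÷ (M ∸_) _ m)) ⟩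
      (1ℚ - tail (suc α)) + Σ' ÷ (M ^ suc (suc α))    ≡⟨ cong₂ (λ u v → (1ℚ - u) + v) tail-rescaled block-rescaled ⟩
      (1ℚ - ((m Nat.+ 3) Nat.* M) ÷ B) + (2 Nat.* Σ') ÷ B
          ≡⟨ cong (λ v → (1ℚ - v ÷ B) + (2 Nat.* Σ') ÷ B) (trans (shape₃ m) (cong (Nat._+ (m Nat.+ 3)) (sym later-block-num))) ⟩
      (1ℚ - (2 Nat.* Σ' Nat.+ (m Nat.+ 3)) ÷ B) + (2 Nat.* Σ') ÷ B
          ≡⟨ cong (λ v → (1ℚ - v) + (2 Nat.* Σ') ÷ B) (sym (÷-+ (2 Nat.* Σ') (m Nat.+ 3) B)) ⟩
      (1ℚ - ((2 Nat.* Σ') ÷ B + (m Nat.+ 3) ÷ B)) + (2 Nat.* Σ') ÷ B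
          ≡⟨ solve 2 (λ x y → (con 1ℚ :- (x :+ y)) :+ x := con 1ℚ :- y) refl ((2 Nat.* Σ') ÷ B) ((m Nat.+ 3) ÷ B) ⟩
      1ℚ - tail (suc (suc α))                          ∎
      where
      open ≡-Reasoning
      Σ' : ℕ
      Σ' = ∑ (λ β → M ∸ β) m
      B : ℕ
      B = 2 Nat.* M ^ suc (suc α)
      shape₁ : ∀ a M p → a Nat.* (2 Nat.* (M Nat.* p)) ≡ (a Nat.* M) Nat.* (2 Nat.* p)
      shape₁ = solve-∀
      shape₂ : ∀ s X → s Nat.* (2 Nat.* X) ≡ (2 Nat.* s) Nat.* X
      shape₂ = solve-∀
      shape₃ : ∀ m → (m Nat.+ 3) Nat.* suc m ≡ m Nat.* (m Nat.+ 3) Nat.+ (m Nat.+ 3)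
      shape₃ = solve-∀
      tail-rescaled : tail (suc α) ≡ ((m Nat.+ 3) Nat.* M) ÷ B
      tail-rescaled = ÷-cross _ _ _ _ (pos⇒≢0 (2M^-pos (suc α))) (pos⇒≢0 (2M^-pos (suc (suc α)))) (shape₁ (m Nat.+ 3) M (M ^ suc α))
      block-rescaled : Σ' ÷ (M ^ suc (suc α)) ≡ (2 Nat.* Σ') ÷ B
      block-rescaled = ÷-cross _ _ _ _ (pos⇒≢0 (M^-pos (suc (suc α)))) (pos⇒≢0 (2M^-pos (suc (suc α)))) (shape₂ Σ' (M ^ suc (suc α)))

    ΣP-bin-end : ∀ α → ΣP (suc α Nat.* m ∸ 1) ≡ 1ℚ - tail (suc α)
    ΣP-bin-end α = begin
      ΣP (suc α Nat.* m ∸ 1)                 ≡⟨ ΣP-from-0 (suc α Nat.* m ∸ 1) ⟨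
      ∑ℚ (P m) (suc (suc α Nat.* m ∸ 1))     ≡⟨ cong (∑ℚ (P m)) (ℕₚ.m+[n∸m]≡n {1} (ℕₚ.≤-trans 0<m (ℕₚ.m≤m+n m _))) ⟩
      ∑ℚ (P m) (suc α Nat.* m)               ≡⟨ ∑ℚ-blocks (P m) (suc α) m ⟩
      ∑ℚ block (suc α)                       ≡⟨ blocks-sum α ⟩
      1ℚ - tail (suc α)                      ∎
      where open ≡-Reasoning

    tail-nonneg : ∀ α → 0ℚ ≤ tail α
    tail-nonneg α = ÷-nonneg (m Nat.+ 3) (2 Nat.* M ^ α)

    ΣP≤1 : ∀ K → ΣP K ≤ 1ℚ
    ΣP≤1 K = begin
      ΣP K                          ≤⟨ ΣP-mono K (K' ∸ K) ⟩
      ΣP (K Nat.+ (K' ∸ K))         ≡⟨ cong ΣP (ℕₚ.m+[n∸m]≡n K≤K') ⟩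
      ΣP K'                         ≡⟨ ΣP-bin-end K ⟩
      1ℚ - tail (suc K)             ≤⟨ +-monoʳ-≤ 1ℚ (neg-antimono-≤ (tail-nonneg (suc K))) ⟩
      1ℚ - 0ℚ                       ≡⟨ +-identityʳ 1ℚ ⟩
      1ℚ                            ∎
      where
      open ≤-Reasoning
      K' : ℕ
      K' = suc K Nat.* m ∸ 1
      K≤K' : K Nat.≤ K'
      K≤K' = ℕₚ.∸-monoˡ-≤ 1 (ℕₚ.m≤m*n (suc K) m)

    ΣP-deficit : ∀ α K → suc α Nat.* m ∸ 1 Nat.≤ K → 1ℚ - ΣP K ≤ tail (suc α)
    ΣP-deficit α K K'≤K = begin
      1ℚ - ΣP K                     ≤⟨ +-monoʳ-≤ 1ℚ (neg-antimono-≤ ΣP-at-K) ⟩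
      1ℚ - (1ℚ - tail (suc α))      ≡⟨ solve 1 (λ t → con 1ℚ :- (con 1ℚ :- t) := t) refl (tail (suc α)) ⟩
      tail (suc α)                  ∎
      where
      open ≤-Reasoning
      K' : ℕ
      K' = suc α Nat.* m ∸ 1
      ΣP-at-K : 1ℚ - tail (suc α) ≤ ΣP K
      ΣP-at-K = ≤-trans (≤-reflexive (sym (ΣP-bin-end α))) (≤-trans (ΣP-mono K' (K ∸ K')) (≤-reflexive (cong ΣP (ℕₚ.m+[n∸m]≡n K'≤K))))

    k<M^k : ∀ k → k Nat.< M ^ k
    k<M^k zero = Nat.s≤s Nat.z≤n
    k<M^k (suc k) = subst (Nat._≤ M ^ suc k) (ℕₚ.+-comm (suc k) 1)
      (ℕₚ.+-mono-≤ (k<M^k k) (ℕₚ.*-mono-≤ {1} {m} {1} {M ^ k} 0<m (M^-pos k)))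

    -- Enough bins to make twice the tail at most 1/(e+1).
    bins : ℕ → ℕ
    bins e = (m Nat.+ 3) Nat.* suc e

    twice-tail-small : ∀ e → ι 2 * tail (suc (bins e)) ≤ 1 ÷ suc e
    twice-tail-small e = begin
      ι 2 * tail (suc (bins e))                       ≡⟨ ι-*-÷ 2 (m Nat.+ 3) B ⟩
      (2 Nat.* (m Nat.+ 3)) ÷ B                       ≤⟨ ÷-≤ _ B 1 (suc e) (pos⇒≢0 (2M^-pos (suc (bins e)))) (λ ()) cross ⟩
      1 ÷ suc e                                       ∎
      where
      open ≤-Reasoning
      B : ℕ
      B = 2 Nat.* M ^ suc (bins e)
      bins≤ : bins e Nat.≤ M ^ suc (bins e)
      bins≤ = ℕₚ.≤-trans (ℕₚ.<⇒≤ (k<M^k (bins e))) (ℕₚ.m≤n*m (M ^ bins e) M)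
      shape₁ : ∀ a s → 2 Nat.* a Nat.* s ≡ 2 Nat.* (a Nat.* s)
      shape₁ = solve-∀
      cross : 2 Nat.* (m Nat.+ 3) Nat.* suc e Nat.≤ 1 Nat.* B
      cross = subst₂ Nat._≤_ (sym (shape₁ (m Nat.+ 3) (suc e))) (sym (ℕₚ.*-identityˡ B)) (ℕₚ.*-monoʳ-≤ 2 bins≤)

    ΣP-close : ∀ e K → suc (bins e) Nat.* m ∸ 1 Nat.≤ K → ι 2 * (1ℚ - ΣP K) ≤ 1 ÷ suc e
    ΣP-close e K K≥ = ≤-trans (*-monoˡ-≤-nonNeg (ι 2) {{nonNegative (ι-nonneg 2)}} (ΣP-deficit (bins e) K K≥)) (twice-tail-small e)

module Estimates where

  open import Defs using (inv)
  open Fractions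
  open import Data.Nat as Nat using (ℕ; zero; suc)
  import Data.Nat.Properties as ℕₚ
  open import Data.Integer as ℤ using (+_; -[1+_])
  import Data.Integer.Properties as ℤP
  open import Data.Rational using (ℚ; 0ℚ; 1ℚ; mkℚ; _+_; _*_; _-_; -_; _≤_; _<_; ∣_∣; *≤*; *<*; nonNegative)
  open import Data.Rational.Properties
  open import Data.Product using (Σ; _,_)
  open import Relation.Binary.PropositionalEquality using (_≡_; _≢_; refl; sym; trans; cong; cong₂; subst₂)
  open import Data.Rational.Solver using (module +-*-Solver)
  open +-*-Solver

  relative-error : ∀ a B r₁ r₂ e → a Nat.+ r₁ ≡ B Nat.+ r₂ → (r₁ Nat.+ r₂) Nat.* suc e Nat.≤ 1 Nat.* B → B ≢ 0
    → ∣ 1ℚ - a ÷ B ∣ ≤ 1 ÷ suc e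
  relative-error a B r₁ r₂ e a+r₁≡B+r₂ small B≢0 = begin
    ∣ 1ℚ - ι a * iB ∣                   ≡⟨ cong ∣_∣ difference ⟩
    ∣ (ι r₁ - ι r₂) * iB ∣              ≡⟨ ∣p*q∣≡∣p∣*∣q∣ (ι r₁ - ι r₂) iB ⟩
    ∣ ι r₁ - ι r₂ ∣ * ∣ iB ∣            ≡⟨ cong (∣ ι r₁ - ι r₂ ∣ *_) (0≤p⇒∣p∣≡p (inv-ι-nonneg B)) ⟩
    ∣ ι r₁ - ι r₂ ∣ * iB                ≤⟨ *-monoʳ-nonneg (inv-ι-nonneg B) triangle ⟩
    ι (r₁ Nat.+ r₂) * iB                ≤⟨ ÷-≤ (r₁ Nat.+ r₂) B 1 (suc e) B≢0 (λ ()) small ⟩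
    1 ÷ suc e                           ∎
    where
    open ≤-Reasoning
    iB : ℚ
    iB = inv (ι B)
    triangle : ∣ ι r₁ - ι r₂ ∣ ≤ ι (r₁ Nat.+ r₂)
    triangle = ≤-trans (∣p-q∣≤∣p∣+∣q∣ (ι r₁) (ι r₂))
      (≤-reflexive (trans (cong₂ _+_ (0≤p⇒∣p∣≡p (ι-nonneg r₁)) (0≤p⇒∣p∣≡p (ι-nonneg r₂))) (sym (ι-+ r₁ r₂))))
    B≡ : ι B ≡ ι a + ι r₁ - ι r₂
    B≡ = trans (solve 2 (λ b r → b := (b :+ r) :- r) refl (ι B) (ι r₂))
               (cong (_- ι r₂) (sym (trans (sym (ι-+ a r₁)) (trans (cong ι a+r₁≡B+r₂) (ι-+ B r₂)))))
    difference : 1ℚ - ι a * iB ≡ (ι r₁ - ι r₂) * iB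
    difference = begin-equality
      1ℚ - ι a * iB                       ≡⟨ cong (_- ι a * iB) (trans (*-comm (ι B) iB) (inv-cancel (ι B) (ι-≢0 B≢0))) ⟨
      ι B * iB - ι a * iB                 ≡⟨ cong (λ v → v * iB - ι a * iB) B≡ ⟩
      (ι a + ι r₁ - ι r₂) * iB - ι a * iB ≡⟨ solve 4 (λ x y r i → (x :+ y :- r) :* i :- x :* i := (y :- r) :* i) refl (ι a) (ι r₁) (ι r₂) iB ⟩
      (ι r₁ - ι r₂) * iB                  ∎

  -- Archimedean property, in the form needed to split ε into two halves.
  archimedean : ∀ ε → 0ℚ < ε → Σ ℕ λ e → 1 ÷ suc e + 1 ÷ suc e < ε
  archimedean (mkℚ (+ zero) q _) (*<* (ℤ.+<+ ()))
  archimedean (mkℚ -[1+ p ] q _) (*<* ())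
  archimedean ε@(mkℚ (+ suc p) q _) _ = e , (begin-strict
    1 ÷ suc e + 1 ÷ suc e          ≡⟨ ÷-+ 1 1 (suc e) ⟩
    2 ÷ suc e                      <⟨ ÷-< 2 e 1 q 2q+2<e+1 ⟩
    1 ÷ suc q                      ≡⟨ cong (_* inv (ι (suc q))) ι-1 ⟩
    1ℚ * inv (ι (suc q))           ≡⟨ *-identityˡ (inv (ι (suc q))) ⟩
    inv (ι (suc q))                ≡⟨ inv-ι-normal q ⟩
    mkℚ (+ 1) q _                  ≤⟨ *≤* (subst₂ ℤ._≤_ (ℤP.pos-* 1 (suc q)) (ℤP.pos-* (suc p) (suc q))
                                            (ℤ.+≤+ (ℕₚ.*-monoˡ-≤ (suc q) {1} {suc p} (Nat.s≤s Nat.z≤n)))) ⟩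
    ε                              ∎)
    where
    open ≤-Reasoning
    e : ℕ
    e = suc (suc (2 Nat.* q))
    2q+2<e+1 : 2 Nat.* suc q Nat.< 1 Nat.* suc e
    2q+2<e+1 = subst₂ Nat._<_ (sym (ℕₚ.*-suc 2 q)) (sym (ℕₚ.*-identityˡ (suc e))) (Nat.s≤s ℕₚ.≤-refl)

  square-defect : ∀ x s → 0ℚ ≤ s → s ≤ 1ℚ → ∣ x - s * s ∣ ≤ ∣ 1ℚ - x ∣ + ι 2 * (1ℚ - s)
  square-defect x s s≥0 s≤1 = begin
    ∣ x - s * s ∣                               ≡⟨ cong ∣_∣ (solve 2 (λ x s → x :- s :* s := (:- (con 1ℚ :- x)) :+ (con 1ℚ :- s) :* (con 1ℚ :+ s)) refl x s) ⟩
    ∣ - (1ℚ - x) + (1ℚ - s) * (1ℚ + s) ∣        ≤⟨ ∣p+q∣≤∣p∣+∣q∣ (- (1ℚ - x)) _ ⟩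
    ∣ - (1ℚ - x) ∣ + ∣ (1ℚ - s) * (1ℚ + s) ∣    ≡⟨ cong₂ _+_ (∣-p∣≡∣p∣ (1ℚ - x)) (0≤p⇒∣p∣≡p (nonneg-* 1-s≥0 1+s≥0)) ⟩
    ∣ 1ℚ - x ∣ + (1ℚ - s) * (1ℚ + s)            ≤⟨ +-monoʳ-≤ ∣ 1ℚ - x ∣ (*-monoˡ-≤-nonNeg (1ℚ - s) {{nonNegative 1-s≥0}} 1+s≤2) ⟩
    ∣ 1ℚ - x ∣ + (1ℚ - s) * ι 2                 ≡⟨ cong (λ v → ∣ 1ℚ - x ∣ + v) (*-comm (1ℚ - s) (ι 2)) ⟩
    ∣ 1ℚ - x ∣ + ι 2 * (1ℚ - s)                 ∎
    where
    open ≤-Reasoning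
    1-s≥0 : 0ℚ ≤ 1ℚ - s
    1-s≥0 = ≤-trans (≤-reflexive (sym (+-inverseʳ s))) (+-monoˡ-≤ (- s) s≤1)
    1+s≥0 : 0ℚ ≤ 1ℚ + s
    1+s≥0 = ≤-trans (≤-reflexive (sym (+-identityʳ 0ℚ))) (+-mono-≤ (≤-trans (ι-nonneg 1) (≤-reflexive ι-1)) s≥0)
    1+s≤2 : 1ℚ + s ≤ ι 2
    1+s≤2 = ≤-trans (+-monoʳ-≤ 1ℚ s≤1) (≤-reflexive (sym (trans (ι-+ 1 1) (cong₂ _+_ ι-1 ι-1))))

open import Defs
open Sums using (∑)
open MGonal using (module Explicit)
open SummandCount using (module Digits)
open Moments using (module SummandMoments)
open Counting using (module GapPairCount)
open Fractions
open RationalSums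
open GapDistribution using (pos⇒≢0; module LimitingDistribution)
open Estimates
open import Data.Nat as Nat using (ℕ; suc; NonZero; _^_; _⊔_; _≥_)
import Data.Nat.Properties as ℕₚ
open import Data.Nat.Tactic.RingSolver using (solve-∀)
open import Data.Rational using (ℚ; 0ℚ; 1ℚ; _+_; _*_; _-_; _≤_; _<_; ∣_∣)
open import Data.Rational.Properties
open import Data.List using (List)
open import Data.Product using (∃; _,_)
open import Relation.Binary.PropositionalEquality using (_≡_; _≢_; refl; sym; trans; cong; cong₂; subst; module ≡-Reasoning)
open import Data.Rational.Solver using (module +-*-Solver)
open +-*-Solver

module Normalisation (m : ℕ) .{{_ : NonZero m}} (a : ℕ → ℕ) (isM : IsMGonal m a)
                     (dec : ℕ → List ℕ) (legal : ∀ z → Legal m a (dec z) z) where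
  open Explicit m using (M)
  open Digits m using (F)
  open SummandMoments m using (T; D; pairs-closed)
  open GapPairCount m a isM dec legal using (totalPairs; sizeI≡F)
  open LimitingDistribution m using (ΣP; M^-pos)

  κ : ℕ → ℚ
  κ n = ℕtoℚ 2 * inv (ℕtoℚ (sizeI m a n) * (μ m n * μ m n))

  μ≡ : ∀ n → μ m n ≡ D n ÷ (2 Nat.* M)
  μ≡ n = begin
    ℕtoℚ (n Nat.* m) * inv (ℕtoℚ M) + ℕtoℚ 1 * inv (ℕtoℚ 2)
        ≡⟨ sym (cong₂ _+_ (cong₂ (λ x y → x * inv y) (ι≡ℕtoℚ (n Nat.* m)) (ι≡ℕtoℚ M)) (cong₂ (λ x y → x * inv y) (ι≡ℕtoℚ 1) (ι≡ℕtoℚ 2))) ⟩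
    (n Nat.* m) ÷ M + 1 ÷ 2
        ≡⟨ cong₂ _+_ (÷-cross _ M (2 Nat.* n Nat.* m) (2 Nat.* M) (λ ()) (λ ()) (shape₁ n m)) (÷-cross 1 2 M (2 Nat.* M) (λ ()) (λ ()) (shape₂ m)) ⟩
    (2 Nat.* n Nat.* m) ÷ (2 Nat.* M) + M ÷ (2 Nat.* M)
        ≡⟨ ÷-+ (2 Nat.* n Nat.* m) M (2 Nat.* M) ⟩
    D n ÷ (2 Nat.* M) ∎
    where
    open ≡-Reasoning
    shape₁ : ∀ n m → n Nat.* m Nat.* (2 Nat.* suc m) ≡ 2 Nat.* n Nat.* m Nat.* suc m
    shape₁ = solve-∀
    shape₂ : ∀ m → 1 Nat.* (2 Nat.* suc m) ≡ suc m Nat.* 2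
    shape₂ = solve-∀

  B : ℕ → ℕ
  B n = M ^ n Nat.* (D n Nat.* D n)

  B-pos : ∀ n → 0 Nat.< B n
  B-pos n = ℕₚ.*-mono-< {0} {M ^ n} {0} {D n Nat.* D n} (M^-pos n) (ℕₚ.*-mono-< {0} {D n} {0} {D n} D-pos D-pos)
    where
    D-pos : 0 Nat.< D n
    D-pos = ℕₚ.≤-trans (Nat.s≤s Nat.z≤n) (ℕₚ.m≤n+m M (2 Nat.* n Nat.* m))

  -- κ n = 4 (m+1)² / ((m+1)^n D n²), since |I_n| μ_n² = 2 (m+1)^n D n² / (4 (m+1)²).
  κ≡ : ∀ n → κ n ≡ (4 Nat.* M Nat.* M) ÷ B n
  κ≡ n = ÷-intro (κ n) (B n) (4 Nat.* M Nat.* M) (pos⇒≢0 (B-pos n)) κB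
    where
    open ≡-Reasoning
    C : ℚ
    C = ι (2 Nat.* M)
    iC : ℚ
    iC = inv C
    Y : ℚ
    Y = ι (F n) * (μ m n * μ m n)
    κ-Y : κ n ≡ ι 2 * inv Y
    κ-Y = sym (cong₂ (λ u v → u * inv (v * (μ m n * μ m n))) (ι≡ℕtoℚ 2) (trans (cong ι (sym (sizeI≡F n))) (ι≡ℕtoℚ (sizeI m a n))))
    C-cancel : iC * C ≡ 1ℚ
    C-cancel = inv-cancel C (ι-≢0 {2 Nat.* M} (λ ()))
    shape₁ : ∀ p d → 2 Nat.* p Nat.* d Nat.* d ≡ 2 Nat.* (p Nat.* (d Nat.* d))
    shape₁ = solve-∀
    YC² : Y * (C * C) ≡ ι (2 Nat.* B n)
    YC² = begin
      ι (F n) * (μ m n * μ m n) * (C * C)                   ≡⟨ cong (λ v → ι (F n) * (v * v) * (C * C)) (μ≡ n) ⟩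
      ι (F n) * ((ι (D n) * iC) * (ι (D n) * iC)) * (C * C)  ≡⟨ solve 4 (λ f d i c → f :* ((d :* i) :* (d :* i)) :* (c :* c) := (f :* d :* d) :* ((i :* c) :* (i :* c))) refl (ι (F n)) (ι (D n)) iC C ⟩
      (ι (F n) * ι (D n) * ι (D n)) * ((iC * C) * (iC * C))  ≡⟨ cong (λ v → (ι (F n) * ι (D n) * ι (D n)) * (v * v)) C-cancel ⟩
      (ι (F n) * ι (D n) * ι (D n)) * (1ℚ * 1ℚ)              ≡⟨ *-identityʳ _ ⟩
      ι (F n) * ι (D n) * ι (D n)                            ≡⟨ trans (ι-* (F n Nat.* D n) (D n)) (cong (_* ι (D n)) (ι-* (F n) (D n))) ⟨
      ι (F n Nat.* D n Nat.* D n)                            ≡⟨ cong ι (shape₁ (M ^ n) (D n)) ⟩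
      ι (2 Nat.* B n)                                        ∎
    Y≢0 : Y ≢ 0ℚ
    Y≢0 Y≡0 = ι-≢0 {2 Nat.* B n} (pos⇒≢0 (ℕₚ.≤-trans (B-pos n) (ℕₚ.m≤m+n (B n) _)))
                (trans (sym YC²) (trans (cong (_* (C * C)) Y≡0) (*-zeroˡ (C * C))))
    2-cancel : inv (ι 2) * ι 2 ≡ 1ℚ
    2-cancel = inv-cancel (ι 2) (ι-suc≢0 1)
    shape₂ : ∀ m → 2 Nat.* suc m Nat.* (2 Nat.* suc m) ≡ 4 Nat.* suc m Nat.* suc m
    shape₂ = solve-∀
    κB : κ n * ι (B n) ≡ ι (4 Nat.* M Nat.* M)
    κB = begin
      κ n * ι (B n)                                   ≡⟨ cong₂ _*_ κ-Y (sym (trans (cong (_* ι (B n)) 2-cancel) (*-identityˡ _))) ⟩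
      ι 2 * inv Y * (inv (ι 2) * ι 2 * ι (B n))       ≡⟨ cong (λ v → ι 2 * inv Y * v) (trans (*-assoc (inv (ι 2)) _ _) (cong (inv (ι 2) *_) (sym (ι-* 2 (B n))))) ⟩
      ι 2 * inv Y * (inv (ι 2) * ι (2 Nat.* B n))     ≡⟨ cong (λ v → ι 2 * inv Y * (inv (ι 2) * v)) (sym YC²) ⟩
      ι 2 * inv Y * (inv (ι 2) * (Y * (C * C)))       ≡⟨ solve 5 (λ q iy iq y c → q :* iy :* (iq :* (y :* c)) := (iq :* q) :* (iy :* y) :* c) refl (ι 2) (inv Y) (inv (ι 2)) Y (C * C) ⟩
      (inv (ι 2) * ι 2) * (inv Y * Y) * (C * C)       ≡⟨ cong₂ (λ u v → u * v * (C * C)) 2-cancel (inv-cancel Y Y≢0) ⟩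
      1ℚ * 1ℚ * (C * C)                               ≡⟨ *-identityˡ _ ⟩
      C * C                                           ≡⟨ ι-* (2 Nat.* M) (2 Nat.* M) ⟨
      ι (2 Nat.* M Nat.* (2 Nat.* M))                 ≡⟨ cong ι (shape₂ m) ⟩
      ι (4 Nat.* M Nat.* M)                           ∎

  errSum≡ : ∀ n K → errSum m a dec n K ≡ κ n * ι (totalPairs n K) - ΣP K * ΣP K
  errSum≡ n K = begin
    ∑ℚ (λ g₁ → ∑ℚ (λ g₂ → κ n * ℕtoℚ (s g₁ g₂) - P m (suc g₁) * P m (suc g₂)) K) K
        ≡⟨ ∑ℚ-cong K (λ g₁ → row g₁) ⟩
    ∑ℚ (λ g₁ → κ n * ι (∑ (s g₁) K) - P m (suc g₁) * ΣP K) K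
        ≡⟨ ∑ℚ-- (λ g₁ → κ n * ι (∑ (s g₁) K)) (λ g₁ → P m (suc g₁) * ΣP K) K ⟩
    ∑ℚ (λ g₁ → κ n * ι (∑ (s g₁) K)) K - ∑ℚ (λ g₁ → P m (suc g₁) * ΣP K) K
        ≡⟨ cong₂ _-_ (trans (∑ℚ-*ˡ (κ n) (λ g₁ → ι (∑ (s g₁) K)) K) (cong (κ n *_) (∑ℚ-ι (λ g₁ → ∑ (s g₁) K) K)))
                     (∑ℚ-*ʳ (ΣP K) (λ g₁ → P m (suc g₁)) K) ⟩
    κ n * ι (totalPairs n K) - ΣP K * ΣP K ∎
    where
    open ≡-Reasoning
    s : ℕ → ℕ → ℕ
    s g₁ g₂ = sumX m a dec n (suc g₁) (suc g₂)
    row : ∀ g₁ → ∑ℚ (λ g₂ → κ n * ℕtoℚ (s g₁ g₂) - P m (suc g₁) * P m (suc g₂)) K ≡ κ n * ι (∑ (s g₁) K) - P m (suc g₁) * ΣP K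
    row g₁ = begin
      ∑ℚ (λ g₂ → κ n * ℕtoℚ (s g₁ g₂) - P m (suc g₁) * P m (suc g₂)) K
          ≡⟨ ∑ℚ-- (λ g₂ → κ n * ℕtoℚ (s g₁ g₂)) (λ g₂ → P m (suc g₁) * P m (suc g₂)) K ⟩
      ∑ℚ (λ g₂ → κ n * ℕtoℚ (s g₁ g₂)) K - ∑ℚ (λ g₂ → P m (suc g₁) * P m (suc g₂)) K
          ≡⟨ cong₂ _-_ (trans (∑ℚ-*ˡ (κ n) (λ g₂ → ℕtoℚ (s g₁ g₂)) K)
                              (cong (κ n *_) (trans (∑ℚ-cong K (λ g₂ → sym (ι≡ℕtoℚ (s g₁ g₂)))) (∑ℚ-ι (s g₁) K))))
                       (∑ℚ-*ˡ (P m (suc g₁)) (λ g₂ → P m (suc g₂)) K) ⟩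
      κ n * ι (∑ (s g₁) K) - P m (suc g₁) * ΣP K ∎

  r₁ r₂ : ℕ → ℕ
  r₁ n = 6 Nat.* M Nat.* (M ^ n Nat.* D n) Nat.+ 4 Nat.* M Nat.* M
  r₂ n = M ^ n Nat.* (4 Nat.* n Nat.* m Nat.+ M Nat.* M Nat.+ 8 Nat.* M Nat.* M)

  pairs-balance : ∀ n → 4 Nat.* M Nat.* M Nat.* T n Nat.+ r₁ n ≡ B n Nat.+ r₂ n
  pairs-balance n = trans (sym (ℕₚ.+-assoc (4 Nat.* M Nat.* M Nat.* T n) _ _))
    (trans (pairs-closed n) (shape (M ^ n) (4 Nat.* n Nat.* m Nat.+ M Nat.* M) (D n) (8 Nat.* M Nat.* M)))
    where
    shape : ∀ P x d y → P Nat.* (x Nat.+ d Nat.* d Nat.+ y) ≡ P Nat.* (d Nat.* d) Nat.+ P Nat.* (x Nat.+ y)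
    shape = solve-∀

  -- The remainders are O((m+1)^n D n), i.e. of lower order than B n.
  remainders≤ : ∀ n → r₁ n Nat.+ r₂ n Nat.≤ M ^ n Nat.* (21 Nat.* M Nat.* D n)
  remainders≤ n = begin
    r₁ n Nat.+ r₂ n
        ≤⟨ ℕₚ.+-monoˡ-≤ (r₂ n) (ℕₚ.+-monoʳ-≤ (6 Nat.* M Nat.* (M ^ n Nat.* D n)) 4M²≤) ⟩
    6 Nat.* M Nat.* (M ^ n Nat.* D n) Nat.+ 4 Nat.* M Nat.* M Nat.* M ^ n Nat.+ r₂ n
        ≡⟨ shape₁ (M ^ n) M (D n) n m ⟩
    M ^ n Nat.* (6 Nat.* M Nat.* D n Nat.+ 13 Nat.* M Nat.* M Nat.+ 4 Nat.* n Nat.* m)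
        ≤⟨ ℕₚ.*-monoʳ-≤ (M ^ n) inner ⟩
    M ^ n Nat.* (21 Nat.* M Nat.* D n) ∎
    where
    open ℕₚ.≤-Reasoning
    4M²≤ : 4 Nat.* M Nat.* M Nat.≤ 4 Nat.* M Nat.* M Nat.* M ^ n
    4M²≤ = ℕₚ.≤-trans (ℕₚ.≤-reflexive (sym (ℕₚ.*-identityʳ (4 Nat.* M Nat.* M)))) (ℕₚ.*-monoʳ-≤ (4 Nat.* M Nat.* M) (M^-pos n))
    shape₁ : ∀ P M d n m → 6 Nat.* M Nat.* (P Nat.* d) Nat.+ 4 Nat.* M Nat.* M Nat.* P Nat.+ P Nat.* (4 Nat.* n Nat.* m Nat.+ M Nat.* M Nat.+ 8 Nat.* M Nat.* M)
             ≡ P Nat.* (6 Nat.* M Nat.* d Nat.+ 13 Nat.* M Nat.* M Nat.+ 4 Nat.* n Nat.* m)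
    shape₁ = solve-∀
    shape₂ : ∀ M d → 6 Nat.* M Nat.* d Nat.+ 13 Nat.* M Nat.* d Nat.+ 2 Nat.* (M Nat.* d) ≡ 21 Nat.* M Nat.* d
    shape₂ = solve-∀
    shape₃ : ∀ n m → 4 Nat.* n Nat.* m ≡ 2 Nat.* (2 Nat.* n Nat.* m)
    shape₃ = solve-∀
    M≤D : M Nat.≤ D n
    M≤D = ℕₚ.m≤n+m M (2 Nat.* n Nat.* m)
    4nm≤ : 4 Nat.* n Nat.* m Nat.≤ 2 Nat.* (M Nat.* D n)
    4nm≤ = ℕₚ.≤-trans (ℕₚ.≤-reflexive (shape₃ n m)) (ℕₚ.*-monoʳ-≤ 2 (ℕₚ.≤-trans (ℕₚ.m≤m+n (2 Nat.* n Nat.* m) M) (ℕₚ.m≤n*m (D n) M)))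
    inner : 6 Nat.* M Nat.* D n Nat.+ 13 Nat.* M Nat.* M Nat.+ 4 Nat.* n Nat.* m Nat.≤ 21 Nat.* M Nat.* D n
    inner = ℕₚ.≤-trans (ℕₚ.+-mono-≤ (ℕₚ.+-monoʳ-≤ (6 Nat.* M Nat.* D n) (ℕₚ.*-monoʳ-≤ (13 Nat.* M) M≤D)) 4nm≤) (ℕₚ.≤-reflexive (shape₂ M (D n)))

  pair-density : ∀ n e → 21 Nat.* M Nat.* suc e Nat.≤ n → ∣ 1ℚ - κ n * ι (T n) ∣ ≤ 1 ÷ suc e
  pair-density n e n≥ = subst (λ v → ∣ 1ℚ - v ∣ ≤ 1 ÷ suc e) (sym κT≡)
    (relative-error (4 Nat.* M Nat.* M Nat.* T n) (B n) (r₁ n) (r₂ n) e (pairs-balance n) small (pos⇒≢0 (B-pos n)))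
    where
    κT≡ : κ n * ι (T n) ≡ (4 Nat.* M Nat.* M Nat.* T n) ÷ B n
    κT≡ = trans (cong (_* ι (T n)) (κ≡ n))
          (trans (solve 3 (λ x i y → x :* i :* y := (x :* y) :* i) refl (ι (4 Nat.* M Nat.* M)) (inv (ι (B n))) (ι (T n)))
                 (cong (_* inv (ι (B n))) (sym (ι-* (4 Nat.* M Nat.* M) (T n)))))
    n≤D : n Nat.≤ D n
    n≤D = ℕₚ.≤-trans (ℕₚ.m≤m*n n m) (ℕₚ.≤-trans (ℕₚ.≤-trans (ℕₚ.m≤m+n (n Nat.* m) (n Nat.* m)) (ℕₚ.≤-reflexive (shape₀ n m))) (ℕₚ.m≤m+n (2 Nat.* n Nat.* m) M))
      where
      shape₀ : ∀ n m → n Nat.* m Nat.+ n Nat.* m ≡ 2 Nat.* n Nat.* m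
      shape₀ = solve-∀
    shape₁ : ∀ P M d s → P Nat.* (21 Nat.* M Nat.* d) Nat.* s ≡ P Nat.* d Nat.* (21 Nat.* M Nat.* s)
    shape₁ = solve-∀
    shape₂ : ∀ P d → P Nat.* d Nat.* d ≡ 1 Nat.* (P Nat.* (d Nat.* d))
    shape₂ = solve-∀
    small : (r₁ n Nat.+ r₂ n) Nat.* suc e Nat.≤ 1 Nat.* B n
    small = ℕₚ.≤-trans (ℕₚ.*-monoˡ-≤ (suc e) (remainders≤ n))
            (ℕₚ.≤-trans (ℕₚ.≤-reflexive (shape₁ (M ^ n) M (D n) (suc e)))
            (ℕₚ.≤-trans (ℕₚ.*-monoʳ-≤ (M ^ n Nat.* D n) (ℕₚ.≤-trans n≥ n≤D)) (ℕₚ.≤-reflexive (shape₂ (M ^ n) (D n)))))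

-- Proposition 5.2: Σ_{g₁,g₂} error(n, g₁, g₂) → 0.  Given ε, choose e with
-- 2/(e+1) < ε; for n ≥ 21 (m+1)(e+1) the normalised pair count is within
-- 1/(e+1) of 1, and once K covers all gaps in I_n and enough bins of P, the
-- squared partial sum of P is within 1/(e+1) of 1 as well.
proposition5p2 : (m : ℕ) → .{{_ : NonZero m}} → (a : ℕ → ℕ) → IsMGonal m a
    → (dec : ℕ → List ℕ) → (∀ z → Legal m a (dec z) z)
    → ∀ (ε : ℚ) → 0ℚ < ε → ∃ λ N → ∀ n → n ≥ N
    → ∃ λ K₀ → ∀ K → K ≥ K₀ → ∣ errSum m a dec n K ∣ < ε
proposition5p2 m a isM dec legal ε ε>0 with archimedean ε ε>0
... | e , 2/[e+1]<ε = 21 Nat.* M Nat.* suc e , λ n n≥N → K₀ n , λ K K≥K₀ → begin-strict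
    ∣ errSum m a dec n K ∣                                   ≡⟨ cong ∣_∣ (errSum≡ n K) ⟩
    ∣ κ n * ι (totalPairs n K) - ΣP K * ΣP K ∣               ≡⟨ cong (λ t → ∣ κ n * ι t - ΣP K * ΣP K ∣) (totalPairs≡T n K (ℕₚ.≤-trans (ℕₚ.m≤m⊔n _ _) K≥K₀)) ⟩
    ∣ κ n * ι (T n) - ΣP K * ΣP K ∣                          ≤⟨ square-defect (κ n * ι (T n)) (ΣP K) (ΣP-mono 0 K) (ΣP≤1 K) ⟩
    ∣ 1ℚ - κ n * ι (T n) ∣ + ι 2 * (1ℚ - ΣP K)                ≤⟨ +-mono-≤ (pair-density n e n≥N) (ΣP-close e K (ℕₚ.≤-trans (ℕₚ.m≤n⊔m _ _) K≥K₀)) ⟩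
    1 ÷ suc e + 1 ÷ suc e                                    <⟨ 2/[e+1]<ε ⟩
    ε                                                        ∎
  where
  open Explicit m using (M)
  open SummandMoments m using (T)
  open GapPairCount m a isM dec legal using (totalPairs; totalPairs≡T)
  open LimitingDistribution m using (ΣP; ΣP-mono; ΣP≤1; ΣP-close; bins)
  open Normalisation m a isM dec legal using (κ; errSum≡; pair-density)
  open ≤-Reasoning
  -- all gap lengths inside I_n, and enough bins of P
  K₀ : ℕ → ℕ
  K₀ n = m Nat.* n ⊔ (suc (bins e) Nat.* m Nat.∸ 1)
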